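{- For $|q|<1$ and every integer $m\ge 0$, $$\sum_{n=0}^{\infty}\frac{(-q)^{n}}{(-q;q)_{m+n-1}(q;q)_n}=\frac{(-1)^{m-1}}{q^{m(m-1)/2}}\Big[\frac{a_m(q)-b_m(q)}{(-q;q^2)_{\infty}}-\frac{b_m(q)}{(-q^2;q^2)_{\infty}}\Big],$$ where $a_0(q)=0$, $b_0(q)=1$, and for $m\ge1$ $$a_m(q)=\sum_{n,l\ge0}q^{n(n-1)/2+l(l+1)/2}\begin{bmatrix} m-1-l\\ n\end{bmatrix}\begin{bmatrix} n\\ l\end{bmatrix},\qquad b_m(q)=\sum_{n,l\ge0}q^{n(n+1)/2+l(l+1)/2}\begin{bmatrix} m-2-l\\ n\end{bmatrix}\begin{bmatrix} n\\ l\end{bmatrix}.$$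
   Context: $(a;q)_\infty=\prod_{k\ge0}(1-aq^k)$ and, for every integer $n$ (including negative $n$), $(a;q)_n=(a;q)_\infty/(aq^n;q)_\infty$; thus $(a;q)_n=\prod_{k=0}^{n-1}(1-aq^k)$ for $n\ge0$ and $(a;q)_{ -1}=1/(1-a/q)$. The Gaussian polynomial $\begin{bmatrix} N\\ M\end{bmatrix}$ equals $\frac{(q;q)_N}{(q;q)_M(q;q)_{N-M}}$ if $0\le M\le N$ and $0$ otherwise. -}

module Defs where

-- Formal power series in q over ℚ, represented by coefficient sequences.
open import Data.Nat as ℕ using (ℕ; zero; suc; _∸_; _≤ᵇ_; _≡ᵇ_)
open import Data.Integer as ℤ using (ℤ; +_; -[1+_])
open import Data.Rational using (ℚ; 0ℚ; 1ℚ; _+_; _*_; -_; 1/_; ≢-nonZero)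
open import Data.Rational.Properties using (_≟_)
open import Data.Bool using (if_then_else_)
open import Relation.Nullary using (yes; no)
open import Relation.Binary.PropositionalEquality using (_≡_)

PS : Set
PS = ℕ → ℚ

_≈ₚ_ : PS → PS → Set
f ≈ₚ g = ∀ N → f N ≡ g N
infix 4 _≈ₚ_

sumTo : ℕ → (ℕ → ℚ) → ℚ
sumTo zero    f = f 0
sumTo (suc n) f = sumTo n f + f (suc n)

zeroPS : PS
zeroPS _ = 0ℚ

cst : ℚ → PS
cst c zero    = c
cst c (suc _) = 0ℚ

onePS : PS
onePS = cst 1ℚ

X^ : ℕ → PS
X^ k n = if k ≡ᵇ n then 1ℚ else 0ℚ

infixl 6 _⊕_ _⊖_
infixl 7 _⊛_ _·_
infix  8 ⊝_

_⊕_ : PS → PS → PS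
(f ⊕ g) n = f n + g n

⊝_ : PS → PS
(⊝ f) n = - f n

_⊖_ : PS → PS → PS
f ⊖ g = f ⊕ (⊝ g)

_·_ : ℚ → PS → PS
(c · f) n = c * f n

_⊛_ : PS → PS → PS
(f ⊛ g) n = sumTo n (λ i → f i * g (n ∸ i))

_^ₚ_ : PS → ℕ → PS
f ^ₚ zero  = onePS
f ^ₚ suc k = (f ^ₚ k) ⊛ f

prodTo : ℕ → (ℕ → PS) → PS
prodTo zero    F = onePS
prodTo (suc n) F = prodTo n F ⊛ F n

-- Multiplicative inverse of a series f with f 0 ≠ 0:
-- b_0 = c = 1/f_0,  b_k = - c * Σ_{i=1}^{k} f_i b_{k-i}.
-- invUpTo f c N k is correct for k ≤ N.
invUpTo : PS → ℚ → ℕ → ℕ → ℚ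
invUpTo f c zero    k = c
invUpTo f c (suc N) k =
  if k ≤ᵇ N then invUpTo f c N k
  else - (c * sumTo k (λ i → if i ≡ᵇ 0 then 0ℚ else f i * invUpTo f c N (k ∸ i)))

-- (junk value zeroPS when f 0 = 0; never used in the statement)
inv : PS → PS
inv f with f 0 ≟ 0ℚ
... | yes _  = zeroPS
... | no f0≢0 = λ N → invUpTo f (1/_ (f 0) {{≢-nonZero f0≢0}}) N N

-- division by q^k (valid when f is divisible by q^k)
shiftDown : PS → ℕ → PS
shiftDown f k n = f (n ℕ.+ k)

poch : PS → PS → ℕ → PS
poch a p n = prodTo n (λ k → onePS ⊖ a ⊛ (p ^ₚ k))

-- (a;p)_∞ for a, p with zero constant term: the coefficient of q^N only
-- depends on the factors k ≤ N, so it equals that of (a;p)_{N+1}.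
pochInf : PS → PS → PS
pochInf a p N = poch a p (suc N) N

-- (a;q)_n for integer n, base q:  n ≥ 0 finite product;
-- n = -r < 0 : (a;q)_{-r} = 1 / ∏_{k=1}^{r} (1 - a q^{-k})  (a divisible by q^r)
pochℤ : PS → ℤ → PS
pochℤ a (+ n)    = poch a (X^ 1) n
pochℤ a -[1+ r ] = inv (prodTo (suc r) (λ k → onePS ⊖ shiftDown a (suc k)))

gauss : ℤ → ℕ → PS
gauss -[1+ _ ] M = zeroPS
gauss (+ N)    M =
  if M ≤ᵇ N
  then poch (X^ 1) (X^ 1) N ⊛ inv (poch (X^ 1) (X^ 1) M ⊛ poch (X^ 1) (X^ 1) (N ∸ M))
  else zeroPS

-- Σ_{n ≥ 0} T n, for terms with T n divisible by q^n (formally convergent)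
sumPS : (ℕ → PS) → PS
sumPS T N = sumTo N (λ n → T n N)

sgn : ℕ → ℚ
sgn zero    = 1ℚ
sgn (suc n) = - sgn n

tri₋ : ℕ → ℕ
tri₋ n = (n ℕ.* (n ∸ 1)) ℕ./ 2

tri₊ : ℕ → ℕ
tri₊ n = (n ℕ.* suc n) ℕ./ 2

qq : PS
qq = X^ 1

lhs : ℕ → PS
lhs m = sumPS (λ n → (sgn n · X^ n) ⊛ inv (pochℤ (⊝ qq) (+ m ℤ.+ + n ℤ.- + 1) ⊛ poch qq qq n))

-- a_m, b_m. The double sums over n,l ≥ 0 are finite: the summand vanishes unless
-- l ≤ n ≤ m; we sum over 0 ≤ n,l ≤ m.
aₘ : ℕ → PS
aₘ zero = zeroPS
aₘ m@(suc _) N = sumTo m (λ n → sumTo m (λ l →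
  (X^ (tri₋ n ℕ.+ tri₊ l) ⊛ gauss (+ m ℤ.- + 1 ℤ.- + l) n ⊛ gauss (+ n) l) N))

bₘ : ℕ → PS
bₘ zero = onePS
bₘ m@(suc _) N = sumTo m (λ n → sumTo m (λ l →
  (X^ (tri₊ n ℕ.+ tri₊ l) ⊛ gauss (+ m ℤ.- + 2 ℤ.- + l) n ⊛ gauss (+ n) l) N))

bracket : ℕ → PS
bracket m = (aₘ m ⊖ bₘ m) ⊛ inv (pochInf (⊝ qq) (X^ 2)) ⊖ bₘ m ⊛ inv (pochInf (⊝ X^ 2) (X^ 2))

module Submission where

-- Let Lₘ be the left-hand side multiplied by q^{m(m-1)/2} and Rₘ the right-hand side. Both satisfy
-- xₘ₊₂ = qᵐ xₘ - (1 + qᵐ) xₘ₊₁, so they agree once they agree for m = 0 and m = 1.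
-- For Lₘ the recurrence holds termwise, by 1/(-q;q)_{k-1} = (1 + qᵏ)/(-q;q)ₖ and (1 - qⁿ)/(q;q)ₙ = 1/(q;q)ₙ₋₁;
-- since (-q;q)ₙ (q;q)ₙ = (q²;q²)ₙ, the initial values are Euler's Σₙ (-1)ⁿ q^{nj}/(q²;q²)ₙ = 1/(-q^j;q²)_∞ for j = 1, 2.
-- For Rₘ it suffices that aₘ and bₘ satisfy cₘ₊₂ = (1 + qᵐ) cₘ₊₁ + qᵐ cₘ. Putting i = l and j = n - l turns the
-- product of Gaussian polynomials into a q-trinomial coefficient, summed over 2i + j + k = m - 1 (resp. m - 2),
-- and the recurrence comes from the q-Pascal rule for trinomial coefficients.

open import Defs
open import Data.Nat as ℕ using (ℕ; zero; suc; _∸_; _≤_; _<_; z≤n; s≤s; _≤ᵇ_; _≡ᵇ_)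
import Data.Nat.Properties as ℕₚ
open import Data.Nat.DivMod using (+-distrib-/-∣ʳ; m*n/n≡m)
open import Data.Nat.Divisibility using (n∣m*n)
open import Data.Nat.Tactic.RingSolver using (solve-∀)
import Data.Integer as ℤ
import Data.Integer.Properties as ℤₚ
open import Data.Rational using (ℚ; 0ℚ; 1ℚ; _+_; _*_; -_; 1/_; ≢-nonZero)
open import Data.Rational.Properties
open import Data.Bool using (T; true; false; if_then_else_)
open import Data.Bool.Properties using (T-≡; ¬-not)
open import Data.Empty using (⊥-elim)
open import Data.Maybe using (Maybe; just; nothing)
open import Data.Product using (_×_; _,_; proj₁)
open import Data.Sum using (inj₁; inj₂)
open import Data.Unit using (tt)
open import Function using (_∘_; Equivalence)
open import Level using (0ℓ)
open import Relation.Binary.PropositionalEquality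
open import Relation.Nullary using (¬_; Dec; yes; no)
open import Algebra.Bundles using (CommutativeRing; CommutativeMonoid)
open import Algebra.Structures using (IsCommutativeRing)
open import Algebra.Properties.CommutativeSemigroup
  (CommutativeMonoid.commutativeSemigroup +-0-commutativeMonoid) using (interchange)
import Algebra.Solver.Ring.AlmostCommutativeRing as ACR
import Algebra.Solver.Ring
import Relation.Binary.Reasoning.Setoid as SetoidReasoning

≤ᵇ-true : ∀ {m n} → m ≤ n → (m ≤ᵇ n) ≡ true
≤ᵇ-true m≤n = Equivalence.to T-≡ (ℕₚ.≤⇒≤ᵇ m≤n)

≤ᵇ-false : ∀ {m n} → ¬ m ≤ n → (m ≤ᵇ n) ≡ false
≤ᵇ-false {m} {n} m≰n = ¬-not (λ m≤ᵇn → m≰n (ℕₚ.≤ᵇ⇒≤ m n (subst T (sym m≤ᵇn) tt)))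

≡ᵇ-true : ∀ m → (m ≡ᵇ m) ≡ true
≡ᵇ-true m = Equivalence.to T-≡ (ℕₚ.≡⇒≡ᵇ m m refl)

≡ᵇ-false : ∀ {m n} → m ≢ n → (m ≡ᵇ n) ≡ false
≡ᵇ-false {m} {n} m≢n = ¬-not (λ m≡ᵇn → m≢n (ℕₚ.≡ᵇ⇒≡ m n (subst T (sym m≡ᵇn) tt)))

sumTo-cong : ∀ n {f g : ℕ → ℚ} → (∀ i → i ≤ n → f i ≡ g i) → sumTo n f ≡ sumTo n g
sumTo-cong zero    f≡g = f≡g 0 z≤n
sumTo-cong (suc n) f≡g =
  cong₂ _+_ (sumTo-cong n (λ i i≤n → f≡g i (ℕₚ.m≤n⇒m≤1+n i≤n))) (f≡g (suc n) ℕₚ.≤-refl)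

sumTo-+ : ∀ n (f g : ℕ → ℚ) → sumTo n (λ i → f i + g i) ≡ sumTo n f + sumTo n g
sumTo-+ zero    f g = refl
sumTo-+ (suc n) f g =
  trans (cong (_+ (f (suc n) + g (suc n))) (sumTo-+ n f g))
        (interchange (sumTo n f) (sumTo n g) (f (suc n)) (g (suc n)))

sumTo-*ˡ : ∀ n c (f : ℕ → ℚ) → c * sumTo n f ≡ sumTo n (λ i → c * f i)
sumTo-*ˡ zero    c f = refl
sumTo-*ˡ (suc n) c f =
  trans (*-distribˡ-+ c (sumTo n f) (f (suc n))) (cong (_+ c * f (suc n)) (sumTo-*ˡ n c f))

sumTo-*ʳ : ∀ n c (f : ℕ → ℚ) → sumTo n f * c ≡ sumTo n (λ i → f i * c)
sumTo-*ʳ n c f =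
  trans (*-comm (sumTo n f) c) (trans (sumTo-*ˡ n c f) (sumTo-cong n (λ i _ → *-comm c (f i))))

sumTo-neg : ∀ n (f : ℕ → ℚ) → - sumTo n f ≡ sumTo n (λ i → - f i)
sumTo-neg zero    f = refl
sumTo-neg (suc n) f =
  trans (neg-distrib-+ (sumTo n f) (f (suc n))) (cong (_+ - f (suc n)) (sumTo-neg n f))

sumTo-zero : ∀ n (f : ℕ → ℚ) → (∀ i → i ≤ n → f i ≡ 0ℚ) → sumTo n f ≡ 0ℚ
sumTo-zero zero    f f≡0 = f≡0 0 z≤n
sumTo-zero (suc n) f f≡0 =
  trans (cong₂ _+_ (sumTo-zero n f (λ i i≤n → f≡0 i (ℕₚ.m≤n⇒m≤1+n i≤n))) (f≡0 (suc n) ℕₚ.≤-refl))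
        (+-identityʳ 0ℚ)

sumTo-suc : ∀ n (f : ℕ → ℚ) → sumTo (suc n) f ≡ f 0 + sumTo n (λ i → f (suc i))
sumTo-suc zero    f = refl
sumTo-suc (suc n) f = trans (cong (_+ f (suc (suc n))) (sumTo-suc n f)) (+-assoc (f 0) _ _)

sumTo-swap : ∀ n m (g : ℕ → ℕ → ℚ) →
             sumTo n (λ i → sumTo m (g i)) ≡ sumTo m (λ j → sumTo n (λ i → g i j))
sumTo-swap zero    m g = refl
sumTo-swap (suc n) m g =
  trans (cong (_+ sumTo m (g (suc n))) (sumTo-swap n m g)) (sym (sumTo-+ m _ (g (suc n))))

sumTo-reverse : ∀ n (f : ℕ → ℚ) → sumTo n f ≡ sumTo n (λ i → f (n ∸ i))
sumTo-reverse zero    f = refl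
sumTo-reverse (suc n) f = begin
  sumTo (suc n) f
    ≡⟨ sumTo-suc n f ⟩
  f 0 + sumTo n (λ i → f (suc i))
    ≡⟨ cong (f 0 +_) (sumTo-reverse n (λ i → f (suc i))) ⟩
  f 0 + sumTo n (λ i → f (suc (n ∸ i)))
    ≡⟨ +-comm (f 0) _ ⟩
  sumTo n (λ i → f (suc (n ∸ i))) + f 0
    ≡⟨ cong₂ _+_ (sumTo-cong n (λ i i≤n → cong f (sym (ℕₚ.+-∸-assoc 1 i≤n))))
        (cong f (sym (ℕₚ.n∸n≡0 n))) ⟩
  sumTo (suc n) (λ i → f (suc n ∸ i)) ∎
  where open ≡-Reasoning

sumTo-extend : ∀ {n} m (f : ℕ → ℚ) → n ≤ m → (∀ i → n < i → i ≤ m → f i ≡ 0ℚ) →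
               sumTo m f ≡ sumTo n f
sumTo-extend m f n≤m f≡0 with ℕₚ.m≤n⇒m<n∨m≡n n≤m
... | inj₂ refl = refl
sumTo-extend (suc m) f _ f≡0 | inj₁ (s≤s n≤m) =
  trans (cong₂ _+_ (sumTo-extend m f n≤m (λ i n<i i≤m → f≡0 i n<i (ℕₚ.m≤n⇒m≤1+n i≤m)))
                   (f≡0 (suc m) (s≤s n≤m) ℕₚ.≤-refl))
        (+-identityʳ _)

sumTo-dropPrefix : ∀ l m (f : ℕ → ℚ) → (∀ i → i < l → f i ≡ 0ℚ) → l ≤ m →
                   sumTo m f ≡ sumTo (m ∸ l) (λ j → f (l ℕ.+ j))
sumTo-dropPrefix zero    m       f f≡0 l≤m       = refl
sumTo-dropPrefix (suc l) (suc m) f f≡0 (s≤s l≤m) = begin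
  sumTo (suc m) f
    ≡⟨ sumTo-suc m f ⟩
  f 0 + sumTo m (λ i → f (suc i))
    ≡⟨ cong (_+ sumTo m (λ i → f (suc i))) (f≡0 0 (s≤s z≤n)) ⟩
  0ℚ + sumTo m (λ i → f (suc i))
    ≡⟨ +-identityˡ _ ⟩
  sumTo m (λ i → f (suc i))
    ≡⟨ sumTo-dropPrefix l m (λ i → f (suc i)) (λ i i<l → f≡0 (suc i) (s≤s i<l)) l≤m ⟩
  sumTo (m ∸ l) (λ j → f (suc l ℕ.+ j)) ∎
  where open ≡-Reasoning

sumTo-singleton : ∀ n k (f : ℕ → ℚ) → k ≤ n → (∀ i → i ≤ n → i ≢ k → f i ≡ 0ℚ) → sumTo n f ≡ f k
sumTo-singleton zero .zero f z≤n f≡0 = refl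
sumTo-singleton (suc n) k f k≤1+n f≡0 with k ℕ.≟ suc n
... | yes refl =
  trans (cong (_+ f (suc n)) (sumTo-zero n f (λ i i≤n → f≡0 i (ℕₚ.m≤n⇒m≤1+n i≤n) (ℕₚ.<⇒≢ (s≤s i≤n)))))
        (+-identityˡ _)
... | no k≢1+n =
  trans (cong₂ _+_ (sumTo-singleton n k f (ℕₚ.≤-pred (ℕₚ.≤∧≢⇒< k≤1+n k≢1+n))
                                      (λ i i≤n → f≡0 i (ℕₚ.m≤n⇒m≤1+n i≤n)))
                   (f≡0 (suc n) ℕₚ.≤-refl (k≢1+n ∘ sym)))
        (+-identityʳ _)

sumTo-triangle : ∀ n (φ : ℕ → ℕ → ℚ) →
                 sumTo n (λ k → sumTo k (λ i → φ i k)) ≡ sumTo n (λ i → sumTo (n ∸ i) (λ j → φ i (i ℕ.+ j)))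
sumTo-triangle zero    φ = refl
sumTo-triangle (suc n) φ = begin
  sumTo n (λ k → sumTo k (λ i → φ i k)) + (column + φ (suc n) (suc n))
    ≡⟨ cong (_+ (column + φ (suc n) (suc n))) (sumTo-triangle n φ) ⟩
  rows + (column + φ (suc n) (suc n))
    ≡⟨ +-assoc rows column _ ⟨
  (rows + column) + φ (suc n) (suc n)
    ≡⟨ cong₂ _+_ (trans (sym (sumTo-+ n _ _)) (sumTo-cong n extendRow))
                 (cong (φ (suc n)) (sym (ℕₚ.+-identityʳ (suc n)))) ⟩
  sumTo n (λ i → sumTo (suc n ∸ i) (λ j → φ i (i ℕ.+ j))) + φ (suc n) (suc n ℕ.+ 0)
    ≡⟨ cong (λ z → sumTo n (λ i → sumTo (suc n ∸ i) (λ j → φ i (i ℕ.+ j))) + sumTo z (λ j → φ (suc n) (suc n ℕ.+ j)))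
            (sym (ℕₚ.n∸n≡0 n)) ⟩
  sumTo (suc n) (λ i → sumTo (suc n ∸ i) (λ j → φ i (i ℕ.+ j))) ∎
  where
  open ≡-Reasoning
  column = sumTo n (λ i → φ i (suc n))
  rows   = sumTo n (λ i → sumTo (n ∸ i) (λ j → φ i (i ℕ.+ j)))
  extendRow : ∀ i → i ≤ n →
              sumTo (n ∸ i) (λ j → φ i (i ℕ.+ j)) + φ i (suc n) ≡ sumTo (suc n ∸ i) (λ j → φ i (i ℕ.+ j))
  extendRow i i≤n rewrite ℕₚ.+-∸-assoc 1 i≤n =
    cong (λ z → sumTo (n ∸ i) (λ j → φ i (i ℕ.+ j)) + φ i z)
         (sym (trans (ℕₚ.+-suc i (n ∸ i)) (cong suc (ℕₚ.m+[n∸m]≡n i≤n))))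

-- The ring of formal power series

≈ₚ-refl : ∀ {f} → f ≈ₚ f
≈ₚ-refl N = refl

≈ₚ-sym : ∀ {f g} → f ≈ₚ g → g ≈ₚ f
≈ₚ-sym f≈g N = sym (f≈g N)

≈ₚ-trans : ∀ {f g h} → f ≈ₚ g → g ≈ₚ h → f ≈ₚ h
≈ₚ-trans f≈g g≈h N = trans (f≈g N) (g≈h N)

⊕-cong : ∀ {f f′ g g′} → f ≈ₚ f′ → g ≈ₚ g′ → f ⊕ g ≈ₚ f′ ⊕ g′
⊕-cong f≈f′ g≈g′ N = cong₂ _+_ (f≈f′ N) (g≈g′ N)

⊝-cong : ∀ {f g} → f ≈ₚ g → ⊝ f ≈ₚ ⊝ g
⊝-cong f≈g N = cong -_ (f≈g N)

⊖-cong : ∀ {f f′ g g′} → f ≈ₚ f′ → g ≈ₚ g′ → f ⊖ g ≈ₚ f′ ⊖ g′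
⊖-cong f≈f′ g≈g′ = ⊕-cong f≈f′ (⊝-cong g≈g′)

⊛-cong : ∀ {f f′ g g′} → f ≈ₚ f′ → g ≈ₚ g′ → f ⊛ g ≈ₚ f′ ⊛ g′
⊛-cong f≈f′ g≈g′ N = sumTo-cong N (λ i _ → cong₂ _*_ (f≈f′ i) (g≈g′ (N ∸ i)))

⊛-congˡ : ∀ f {g g′} → g ≈ₚ g′ → f ⊛ g ≈ₚ f ⊛ g′
⊛-congˡ f = ⊛-cong (≈ₚ-refl {f})

⊛-congʳ : ∀ {f f′} g → f ≈ₚ f′ → f ⊛ g ≈ₚ f′ ⊛ g
⊛-congʳ g f≈f′ = ⊛-cong f≈f′ (≈ₚ-refl {g})

⊛-comm : ∀ f g → f ⊛ g ≈ₚ g ⊛ f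
⊛-comm f g N =
  trans (sumTo-reverse N (λ i → f i * g (N ∸ i)))
        (sumTo-cong N (λ i i≤N → trans (cong (λ j → f (N ∸ i) * g j) (ℕₚ.m∸[m∸n]≡n i≤N))
                                        (*-comm (f (N ∸ i)) (g i))))

⊛-assoc : ∀ f g h → (f ⊛ g) ⊛ h ≈ₚ f ⊛ (g ⊛ h)
⊛-assoc f g h N = begin
  sumTo N (λ k → sumTo k (λ i → f i * g (k ∸ i)) * h (N ∸ k))
    ≡⟨ sumTo-cong N (λ k _ → sumTo-*ʳ k (h (N ∸ k)) (λ i → f i * g (k ∸ i))) ⟩
  sumTo N (λ k → sumTo k (λ i → f i * g (k ∸ i) * h (N ∸ k)))
    ≡⟨ sumTo-triangle N (λ i k → f i * g (k ∸ i) * h (N ∸ k)) ⟩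
  sumTo N (λ i → sumTo (N ∸ i) (λ j → f i * g ((i ℕ.+ j) ∸ i) * h (N ∸ (i ℕ.+ j))))
    ≡⟨ sumTo-cong N (λ i _ → trans (sumTo-cong (N ∸ i) (λ j _ → regroup i j))
                                   (sym (sumTo-*ˡ (N ∸ i) (f i) (λ j → g j * h ((N ∸ i) ∸ j))))) ⟩
  sumTo N (λ i → f i * sumTo (N ∸ i) (λ j → g j * h ((N ∸ i) ∸ j))) ∎
  where
  open ≡-Reasoning
  regroup : ∀ i j → f i * g ((i ℕ.+ j) ∸ i) * h (N ∸ (i ℕ.+ j)) ≡ f i * (g j * h ((N ∸ i) ∸ j))
  regroup i j = trans (cong₂ (λ a b → f i * g a * h b) (ℕₚ.m+n∸m≡n i j) (sym (ℕₚ.∸-+-assoc N i j)))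
                      (*-assoc (f i) (g j) (h ((N ∸ i) ∸ j)))

⊛-distribˡ : ∀ f g h → f ⊛ (g ⊕ h) ≈ₚ f ⊛ g ⊕ f ⊛ h
⊛-distribˡ f g h N = trans (sumTo-cong N (λ i _ → *-distribˡ-+ (f i) (g (N ∸ i)) (h (N ∸ i)))) (sumTo-+ N _ _)

⊛-distribʳ : ∀ f g h → (g ⊕ h) ⊛ f ≈ₚ g ⊛ f ⊕ h ⊛ f
⊛-distribʳ f g h N = trans (sumTo-cong N (λ i _ → *-distribʳ-+ (f (N ∸ i)) (g i) (h i))) (sumTo-+ N _ _)

cst-⊛ : ∀ c g → cst c ⊛ g ≈ₚ c · g
cst-⊛ c g zero    = refl
cst-⊛ c g (suc N) = begin
  sumTo (suc N) (λ i → cst c i * g (suc N ∸ i))     ≡⟨ sumTo-suc N _ ⟩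
  c * g (suc N) + sumTo N (λ i → 0ℚ * g (N ∸ i))
    ≡⟨ cong (c * g (suc N) +_) (sumTo-zero N _ (λ i _ → *-zeroˡ (g (N ∸ i)))) ⟩
  c * g (suc N) + 0ℚ                                 ≡⟨ +-identityʳ _ ⟩
  c * g (suc N)                                      ∎
  where open ≡-Reasoning

⊛-identityˡ : ∀ f → onePS ⊛ f ≈ₚ f
⊛-identityˡ f N = trans (cst-⊛ 1ℚ f N) (*-identityˡ (f N))

⊛-identityʳ : ∀ f → f ⊛ onePS ≈ₚ f
⊛-identityʳ f N = trans (⊛-comm f onePS N) (⊛-identityˡ f N)

⊛-zeroʳ : ∀ f → f ⊛ zeroPS ≈ₚ zeroPS
⊛-zeroʳ f N = sumTo-zero N _ (λ i _ → *-zeroʳ (f i))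

⊛-zeroˡ : ∀ f → zeroPS ⊛ f ≈ₚ zeroPS
⊛-zeroˡ f = ≈ₚ-trans (⊛-comm zeroPS f) (⊛-zeroʳ f)

⊛-absorbʳ : ∀ f {g} → g ≈ₚ zeroPS → f ⊛ g ≈ₚ zeroPS
⊛-absorbʳ f g≈0 = ≈ₚ-trans (⊛-congˡ f g≈0) (⊛-zeroʳ f)

⊛-absorbˡ : ∀ {f} g → f ≈ₚ zeroPS → f ⊛ g ≈ₚ zeroPS
⊛-absorbˡ g f≈0 = ≈ₚ-trans (⊛-congʳ g f≈0) (⊛-zeroˡ g)

cst-zero : cst 0ℚ ≈ₚ zeroPS
cst-zero zero    = refl
cst-zero (suc N) = refl

cst-neg : ∀ x → cst (- x) ≈ₚ ⊝ cst x
cst-neg x zero    = refl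
cst-neg x (suc N) = refl

PS-isCommutativeRing : IsCommutativeRing _≈ₚ_ _⊕_ _⊛_ ⊝_ zeroPS onePS
PS-isCommutativeRing = record
  { isRing = record
    { +-isAbelianGroup = record
      { isGroup = record
        { isMonoid = record
          { isSemigroup = record
            { isMagma = record
              { isEquivalence = record { refl = ≈ₚ-refl ; sym = ≈ₚ-sym ; trans = ≈ₚ-trans }
              ; ∙-cong = ⊕-cong }
            ; assoc = λ f g h N → +-assoc (f N) (g N) (h N) }
          ; identity = (λ f N → +-identityˡ (f N)) , (λ f N → +-identityʳ (f N)) }
        ; inverse = (λ f N → +-inverseˡ (f N)) , (λ f N → +-inverseʳ (f N))
        ; ⁻¹-cong = ⊝-cong }
      ; comm = λ f g N → +-comm (f N) (g N) }
    ; *-cong = ⊛-cong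
    ; *-assoc = ⊛-assoc
    ; *-identity = ⊛-identityˡ , ⊛-identityʳ
    ; distrib = ⊛-distribˡ , ⊛-distribʳ }
  ; *-comm = ⊛-comm }

PS-commutativeRing : CommutativeRing 0ℓ 0ℓ
PS-commutativeRing = record { isCommutativeRing = PS-isCommutativeRing }

module ≈ₚ-Reasoning = SetoidReasoning (CommutativeRing.setoid PS-commutativeRing)

cst-homomorphism : ACR._-Raw-AlmostCommutative⟶_ (CommutativeRing.rawRing +-*-commutativeRing)
                                                  (ACR.fromCommutativeRing PS-commutativeRing)
cst-homomorphism = record
  { ⟦_⟧    = cst
  ; +-homo = λ { a b zero → refl ; a b (suc N) → sym (+-identityʳ 0ℚ) }
  ; *-homo = λ a b N → sym (trans (cst-⊛ a (cst b) N) (scale a b N))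
  ; -‿homo = cst-neg
  ; 0-homo = cst-zero
  ; 1-homo = λ N → refl }
  where
  scale : ∀ a b N → a * cst b N ≡ cst (a * b) N
  scale a b zero    = refl
  scale a b (suc N) = *-zeroʳ a

cst-≟ : ∀ a b → Maybe (cst a ≈ₚ cst b)
cst-≟ a b with a ≟ b
... | yes refl = just ≈ₚ-refl
... | no _     = nothing

module PS-Solver = Algebra.Solver.Ring (CommutativeRing.rawRing +-*-commutativeRing)
                                       (ACR.fromCommutativeRing PS-commutativeRing) cst-homomorphism cst-≟

·-as-⊛ : ∀ c f → c · f ≈ₚ cst c ⊛ f
·-as-⊛ c f = ≈ₚ-sym (cst-⊛ c f)

⊛-· : ∀ f c g → f ⊛ (c · g) ≈ₚ c · (f ⊛ g)
⊛-· f c g = begin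
  f ⊛ (c · g)         ≈⟨ ⊛-congˡ f (·-as-⊛ c g) ⟩
  f ⊛ (cst c ⊛ g)     ≈⟨ solve 3 (λ f a g → f :* (a :* g) := a :* (f :* g)) ≈ₚ-refl f (cst c) g ⟩
  cst c ⊛ (f ⊛ g)     ≈⟨ cst-⊛ c (f ⊛ g) ⟩
  c · (f ⊛ g)         ∎
  where
  open ≈ₚ-Reasoning
  open PS-Solver using (solve; _:=_; _:*_)

X^-≢ : ∀ {k n} → k ≢ n → X^ k n ≡ 0ℚ
X^-≢ {zero}  {zero}  k≢n = ⊥-elim (k≢n refl)
X^-≢ {zero}  {suc n} k≢n = refl
X^-≢ {suc k} {zero}  k≢n = refl
X^-≢ {suc k} {suc n} k≢n = X^-≢ (k≢n ∘ cong suc)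

X^-diag : ∀ k → X^ k k ≡ 1ℚ
X^-diag zero    = refl
X^-diag (suc k) = X^-diag k

X^-+ : ∀ a b M → X^ (a ℕ.+ b) (a ℕ.+ M) ≡ X^ b M
X^-+ zero    b M = refl
X^-+ (suc a) b M = X^-+ a b M

X^-cong : ∀ {a b} → a ≡ b → X^ a ≈ₚ X^ b
X^-cong refl = ≈ₚ-refl

X^-zero : X^ 0 ≈ₚ onePS
X^-zero zero    = refl
X^-zero (suc N) = refl

one⊖X^0≈0 : onePS ⊖ X^ 0 ≈ₚ zeroPS
one⊖X^0≈0 N = trans (cong (λ x → onePS N + - x) (X^-zero N)) (+-inverseʳ (onePS N))

X^-⊛-below : ∀ a f N → N < a → (X^ a ⊛ f) N ≡ 0ℚ
X^-⊛-below a f N N<a = sumTo-zero N _ (λ i i≤N →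
  trans (cong (_* f (N ∸ i)) (X^-≢ (λ a≡i → ℕₚ.<⇒≢ (ℕₚ.≤-<-trans i≤N N<a) (sym a≡i))))
        (*-zeroˡ (f (N ∸ i))))

X^-⊛-shift : ∀ a f M → (X^ a ⊛ f) (a ℕ.+ M) ≡ f M
X^-⊛-shift a f M = begin
  sumTo (a ℕ.+ M) (λ i → X^ a i * f (a ℕ.+ M ∸ i))
    ≡⟨ sumTo-singleton (a ℕ.+ M) a _ (ℕₚ.m≤m+n a M)
         (λ i _ i≢a → trans (cong (_* f (a ℕ.+ M ∸ i)) (X^-≢ (λ a≡i → i≢a (sym a≡i)))) (*-zeroˡ (f (a ℕ.+ M ∸ i)))) ⟩
  X^ a a * f (a ℕ.+ M ∸ a)
    ≡⟨ cong₂ _*_ (X^-diag a) (cong f (ℕₚ.m+n∸m≡n a M)) ⟩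
  1ℚ * f M
    ≡⟨ *-identityˡ (f M) ⟩
  f M ∎
  where open ≡-Reasoning

X^-⊛-X^ : ∀ a b → X^ a ⊛ X^ b ≈ₚ X^ (a ℕ.+ b)
X^-⊛-X^ a b N with N ℕ.<? a
... | yes N<a = trans (X^-⊛-below a (X^ b) N N<a)
                      (sym (X^-≢ (λ a+b≡N → ℕₚ.<⇒≢ (ℕₚ.<-≤-trans N<a (ℕₚ.m≤m+n a b)) (sym a+b≡N))))
... | no N≮a with ℕₚ.m≤n⇒∃[o]m+o≡n (ℕₚ.≮⇒≥ N≮a)
...   | M , refl = trans (X^-⊛-shift a (X^ b) M) (sym (X^-+ a b M))

X^-⊛-X^-⊛ : ∀ a b f → X^ a ⊛ (X^ b ⊛ f) ≈ₚ X^ (a ℕ.+ b) ⊛ f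
X^-⊛-X^-⊛ a b f = ≈ₚ-trans (≈ₚ-sym (⊛-assoc (X^ a) (X^ b) f)) (⊛-congʳ f (X^-⊛-X^ a b))

X^-^ₚ : ∀ a k → X^ a ^ₚ k ≈ₚ X^ (k ℕ.* a)
X^-^ₚ a zero    = ≈ₚ-sym X^-zero
X^-^ₚ a (suc k) = ≈ₚ-trans (⊛-congʳ (X^ a) (X^-^ₚ a k))
                           (≈ₚ-trans (X^-⊛-X^ (k ℕ.* a) a) (X^-cong (ℕₚ.+-comm (k ℕ.* a) a)))

-- k ≤ₒ f : q^k divides f
_≤ₒ_ : ℕ → PS → Set
k ≤ₒ f = ∀ N → N < k → f N ≡ 0ℚ

infix 4 _≤ₒ_

≤ₒ-weaken : ∀ {a b f} → b ≤ a → a ≤ₒ f → b ≤ₒ f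
≤ₒ-weaken b≤a a≤f N N<b = a≤f N (ℕₚ.<-≤-trans N<b b≤a)

≤ₒ-cong : ∀ {k f g} → f ≈ₚ g → k ≤ₒ f → k ≤ₒ g
≤ₒ-cong f≈g k≤f N N<k = trans (sym (f≈g N)) (k≤f N N<k)

≤ₒ-⊝ : ∀ {k f} → k ≤ₒ f → k ≤ₒ ⊝ f
≤ₒ-⊝ k≤f N N<k = cong -_ (k≤f N N<k)

≤ₒ-· : ∀ {k} c f → k ≤ₒ f → k ≤ₒ c · f
≤ₒ-· c f k≤f N N<k = trans (cong (c *_) (k≤f N N<k)) (*-zeroʳ c)

≤ₒ-X^ : ∀ k → k ≤ₒ X^ k
≤ₒ-X^ k N N<k = X^-≢ (λ k≡N → ℕₚ.<⇒≢ N<k (sym k≡N))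

1≤ₒ-X^suc : ∀ k → 1 ≤ₒ X^ (suc k)
1≤ₒ-X^suc k = ≤ₒ-weaken (s≤s z≤n) (≤ₒ-X^ (suc k))

≤ₒ-⊛ : ∀ {a b} f g → a ≤ₒ f → b ≤ₒ g → a ℕ.+ b ≤ₒ f ⊛ g
≤ₒ-⊛ {a} {b} f g a≤f b≤g N N<a+b = sumTo-zero N _ term≡0
  where
  term≡0 : ∀ i → i ≤ N → f i * g (N ∸ i) ≡ 0ℚ
  term≡0 i i≤N with i ℕ.<? a
  ... | yes i<a = trans (cong (_* g (N ∸ i)) (a≤f i i<a)) (*-zeroˡ (g (N ∸ i)))
  ... | no i≮a  = trans (cong (f i *_) (b≤g (N ∸ i) N∸i<b)) (*-zeroʳ (f i))
    where
    N∸i<b : N ∸ i < b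
    N∸i<b = ℕₚ.+-cancelˡ-< i (N ∸ i) b
              (ℕₚ.<-≤-trans (subst (_< a ℕ.+ b) (sym (ℕₚ.m+[n∸m]≡n i≤N)) N<a+b)
                            (ℕₚ.+-monoˡ-≤ b (ℕₚ.≮⇒≥ i≮a)))

≤ₒ-⊛ˡ : ∀ {k} f g → k ≤ₒ f → k ≤ₒ f ⊛ g
≤ₒ-⊛ˡ {k} f g k≤f = subst (_≤ₒ f ⊛ g) (ℕₚ.+-identityʳ k) (≤ₒ-⊛ f g k≤f (λ N ()))

≤ₒ-⊛ʳ : ∀ {k} f g → k ≤ₒ g → k ≤ₒ f ⊛ g
≤ₒ-⊛ʳ f g k≤g = ≤ₒ-cong (⊛-comm g f) (≤ₒ-⊛ˡ g f k≤g)

Invertible : PS → Set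
Invertible f = f 0 ≢ 0ℚ

module _ (f : PS) (c : ℚ) where

  private
    b : PS
    b k = invUpTo f c k k

  invUpTo-suc : ∀ N k → k ≤ N → invUpTo f c (suc N) k ≡ invUpTo f c N k
  invUpTo-suc N k k≤N rewrite ≤ᵇ-true k≤N = refl

  invUpTo-stable : ∀ N k → k ≤ N → invUpTo f c N k ≡ b k
  invUpTo-stable N k k≤N with ℕₚ.m≤n⇒m<n∨m≡n k≤N
  ... | inj₂ refl = refl
  invUpTo-stable (suc N) k _ | inj₁ (s≤s k≤N) = trans (invUpTo-suc N k k≤N) (invUpTo-stable N k k≤N)

  invUpTo-diag-suc : ∀ k → b (suc k) ≡ - (c * sumTo k (λ i → f (suc i) * b (k ∸ i)))
  invUpTo-diag-suc k rewrite ≤ᵇ-false (ℕₚ.1+n≰n {k}) =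
    cong (λ s → - (c * s))
         (trans (sumTo-suc k _)
                (trans (+-identityˡ _)
                       (sumTo-cong k (λ i _ → cong (f (suc i) *_) (invUpTo-stable k (k ∸ i) (ℕₚ.m∸n≤m k i))))))

  ⊛-invUpTo : f 0 * c ≡ 1ℚ → f ⊛ b ≈ₚ onePS
  ⊛-invUpTo f₀c≡1 zero    = f₀c≡1
  ⊛-invUpTo f₀c≡1 (suc k) = begin
    sumTo (suc k) (λ i → f i * b (suc k ∸ i))
      ≡⟨ sumTo-suc k _ ⟩
    f 0 * b (suc k) + s
      ≡⟨ cong (λ x → f 0 * x + s) (invUpTo-diag-suc k) ⟩
    f 0 * - (c * s) + s
      ≡⟨ cong (_+ s) (trans (sym (neg-distribʳ-* (f 0) (c * s)))
          (cong -_ (sym (*-assoc (f 0) c s)))) ⟩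
    - (f 0 * c * s) + s
      ≡⟨ cong (λ x → - (x * s) + s) f₀c≡1 ⟩
    - (1ℚ * s) + s
      ≡⟨ cong (λ x → - x + s) (*-identityˡ s) ⟩
    - s + s
      ≡⟨ +-inverseˡ s ⟩
    0ℚ ∎
    where
    open ≡-Reasoning
    s = sumTo k (λ i → f (suc i) * b (k ∸ i))

⊛-inv : ∀ f → Invertible f → f ⊛ inv f ≈ₚ onePS
⊛-inv f f₀≢0 with f 0 ≟ 0ℚ
... | yes f₀≡0 = ⊥-elim (f₀≢0 f₀≡0)
... | no f₀≢0′ = ⊛-invUpTo f _ (*-inverseʳ (f 0) {{≢-nonZero f₀≢0′}})

inv-⊛ : ∀ f → Invertible f → inv f ⊛ f ≈ₚ onePS
inv-⊛ f f₀≢0 = ≈ₚ-trans (⊛-comm (inv f) f) (⊛-inv f f₀≢0)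

inv-unique : ∀ f g → Invertible f → f ⊛ g ≈ₚ onePS → inv f ≈ₚ g
inv-unique f g f₀≢0 fg≈1 = begin
  inv f                 ≈⟨ ⊛-identityʳ (inv f) ⟨
  inv f ⊛ onePS         ≈⟨ ⊛-congˡ (inv f) fg≈1 ⟨
  inv f ⊛ (f ⊛ g)       ≈⟨ ⊛-assoc (inv f) f g ⟨
  (inv f ⊛ f) ⊛ g       ≈⟨ ⊛-congʳ g (inv-⊛ f f₀≢0) ⟩
  onePS ⊛ g             ≈⟨ ⊛-identityˡ g ⟩
  g                     ∎
  where open ≈ₚ-Reasoning

inv-zero : ∀ f → f 0 ≡ 0ℚ → inv f ≈ₚ zeroPS
inv-zero f f₀≡0 with f 0 ≟ 0ℚ
... | yes _    = ≈ₚ-refl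
... | no f₀≢0 = ⊥-elim (f₀≢0 f₀≡0)

inv-cong : ∀ {f g} → f ≈ₚ g → inv f ≈ₚ inv g
inv-cong {f} {g} f≈g = byCases (f 0 ≟ 0ℚ)
  where
  byCases : Dec (f 0 ≡ 0ℚ) → inv f ≈ₚ inv g
  byCases (yes f₀≡0) = ≈ₚ-trans (inv-zero f f₀≡0) (≈ₚ-sym (inv-zero g (trans (sym (f≈g 0)) f₀≡0)))
  byCases (no f₀≢0)  = ≈ₚ-sym (inv-unique g (inv f) (f₀≢0 ∘ trans (f≈g 0))
                                          (≈ₚ-trans (⊛-congʳ (inv f) (≈ₚ-sym f≈g)) (⊛-inv f f₀≢0)))

*-≢0 : ∀ {x y} → x ≢ 0ℚ → y ≢ 0ℚ → x * y ≢ 0ℚ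
*-≢0 {x} {y} x≢0 y≢0 xy≡0 = y≢0 (begin
  y                     ≡⟨ *-identityˡ y ⟨
  1ℚ * y                ≡⟨ cong (_* y) (*-inverseˡ x) ⟨
  (1/ x) * x * y        ≡⟨ *-assoc (1/ x) x y ⟩
  (1/ x) * (x * y)      ≡⟨ cong ((1/ x) *_) xy≡0 ⟩
  (1/ x) * 0ℚ           ≡⟨ *-zeroʳ (1/ x) ⟩
  0ℚ                    ∎)
  where
  open ≡-Reasoning
  instance
    x≠0 = ≢-nonZero x≢0

Invertible-⊛ : ∀ f g → Invertible f → Invertible g → Invertible (f ⊛ g)
Invertible-⊛ f g = *-≢0

Invertible-inv : ∀ f → Invertible f → Invertible (inv f)
Invertible-inv f f₀≢0 inv₀≡0 = 1≢0 (begin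
  1ℚ                ≡⟨ ⊛-inv f f₀≢0 0 ⟨
  f 0 * inv f 0     ≡⟨ cong (f 0 *_) inv₀≡0 ⟩
  f 0 * 0ℚ          ≡⟨ *-zeroʳ (f 0) ⟩
  0ℚ                ∎)
  where open ≡-Reasoning

Invertible-1⊖ : ∀ g → 1 ≤ₒ g → Invertible (onePS ⊖ g)
Invertible-1⊖ g 1≤g 1-g₀≡0 = 1≢0 (trans (sym (cong (λ x → 1ℚ + - x) (1≤g 0 (s≤s z≤n)))) 1-g₀≡0)

Invertible-prodTo : ∀ n (F : ℕ → PS) → (∀ k → Invertible (F k)) → Invertible (prodTo n F)
Invertible-prodTo zero    F F-inv ()
Invertible-prodTo (suc n) F F-inv = Invertible-⊛ (prodTo n F) (F n) (Invertible-prodTo n F F-inv) (F-inv n)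

inv-one : inv onePS ≈ₚ onePS
inv-one = inv-unique onePS onePS 1≢0 (⊛-identityˡ onePS)

inv-⊛-distrib : ∀ f g → Invertible f → Invertible g → inv (f ⊛ g) ≈ₚ inv f ⊛ inv g
inv-⊛-distrib f g f₀≢0 g₀≢0 = inv-unique (f ⊛ g) (inv f ⊛ inv g) (Invertible-⊛ f g f₀≢0 g₀≢0) (begin
  (f ⊛ g) ⊛ (inv f ⊛ inv g)     ≈⟨ solve 4 (λ f g f′ g′ → (f :* g) :* (f′ :* g′) := (f :* f′) :* (g :* g′))
                                          ≈ₚ-refl f g (inv f) (inv g) ⟩
  (f ⊛ inv f) ⊛ (g ⊛ inv g)     ≈⟨ ⊛-cong (⊛-inv f f₀≢0) (⊛-inv g g₀≢0) ⟩
  onePS ⊛ onePS                 ≈⟨ ⊛-identityˡ onePS ⟩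
  onePS                         ∎)
  where
  open ≈ₚ-Reasoning
  open PS-Solver using (solve; _:=_; _:*_)

inv-prodTo-suc : ∀ n (F : ℕ → PS) → (∀ k → Invertible (F k)) →
                 F n ⊛ inv (prodTo (suc n) F) ≈ₚ inv (prodTo n F)
inv-prodTo-suc n F F-inv = begin
  F n ⊛ inv (prodTo n F ⊛ F n)
    ≈⟨ ⊛-congˡ (F n) (inv-⊛-distrib (prodTo n F) (F n) (Invertible-prodTo n F F-inv) (F-inv n)) ⟩
  F n ⊛ (inv (prodTo n F) ⊛ inv (F n))
    ≈⟨ solve 3 (λ x y z → x :* (y :* z) := y :* (x :* z)) ≈ₚ-refl (F n) (inv (prodTo n F)) (inv (F n)) ⟩
  inv (prodTo n F) ⊛ (F n ⊛ inv (F n))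
    ≈⟨ ⊛-congˡ (inv (prodTo n F)) (⊛-inv (F n) (F-inv n)) ⟩
  inv (prodTo n F) ⊛ onePS
    ≈⟨ ⊛-identityʳ (inv (prodTo n F)) ⟩
  inv (prodTo n F) ∎
  where
  open ≈ₚ-Reasoning
  open PS-Solver using (solve; _:=_; _:*_)

sumPS-cong : ∀ {T T′ : ℕ → PS} → (∀ n → T n ≈ₚ T′ n) → sumPS T ≈ₚ sumPS T′
sumPS-cong T≈T′ N = sumTo-cong N (λ n _ → T≈T′ n N)

sumPS-⊕ : ∀ (T T′ : ℕ → PS) → sumPS (λ n → T n ⊕ T′ n) ≈ₚ sumPS T ⊕ sumPS T′
sumPS-⊕ T T′ N = sumTo-+ N (λ n → T n N) (λ n → T′ n N)

sumPS-⊝ : ∀ (T : ℕ → PS) → sumPS (λ n → ⊝ T n) ≈ₚ ⊝ sumPS T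
sumPS-⊝ T N = sym (sumTo-neg N (λ n → T n N))

sumPS-⊖ : ∀ (T T′ : ℕ → PS) → sumPS (λ n → T n ⊖ T′ n) ≈ₚ sumPS T ⊖ sumPS T′
sumPS-⊖ T T′ = ≈ₚ-trans (sumPS-⊕ T (λ n → ⊝ T′ n)) (⊕-cong (≈ₚ-refl {sumPS T}) (sumPS-⊝ T′))

sumPS-X^-⊛ : ∀ a (T : ℕ → PS) → (∀ n → n ≤ₒ T n) → sumPS (λ n → X^ a ⊛ T n) ≈ₚ X^ a ⊛ sumPS T
sumPS-X^-⊛ a T n≤Tn N with N ℕ.<? a
... | yes N<a = trans (sumTo-zero N _ (λ n _ → X^-⊛-below a (T n) N N<a)) (sym (X^-⊛-below a (sumPS T) N N<a))
... | no N≮a with ℕₚ.m≤n⇒∃[o]m+o≡n (ℕₚ.≮⇒≥ N≮a)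
...   | M , refl = begin
  sumTo (a ℕ.+ M) (λ n → (X^ a ⊛ T n) (a ℕ.+ M))
    ≡⟨ sumTo-cong (a ℕ.+ M) (λ n _ → X^-⊛-shift a (T n) M) ⟩
  sumTo (a ℕ.+ M) (λ n → T n M)
    ≡⟨ sumTo-extend (a ℕ.+ M) (λ n → T n M) (ℕₚ.m≤n+m M a) (λ n M<n _ → n≤Tn n M M<n) ⟩
  sumPS T M
    ≡⟨ X^-⊛-shift a (sumPS T) M ⟨
  (X^ a ⊛ sumPS T) (a ℕ.+ M) ∎
  where open ≡-Reasoning

sumPS-shift : ∀ (T′ T : ℕ → PS) → T′ 0 ≈ₚ zeroPS → (∀ n → T′ (suc n) ≈ₚ X^ 1 ⊛ T n) →
              sumPS T′ ≈ₚ X^ 1 ⊛ sumPS T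
sumPS-shift T′ T T′₀≈0 T′≈qT zero    = trans (T′₀≈0 0) (sym (X^-⊛-below 1 (sumPS T) 0 (s≤s z≤n)))
sumPS-shift T′ T T′₀≈0 T′≈qT (suc M) = begin
  sumTo (suc M) (λ n → T′ n (suc M))
    ≡⟨ sumTo-suc M (λ n → T′ n (suc M)) ⟩
  T′ 0 (suc M) + sumTo M (λ n → T′ (suc n) (suc M))
    ≡⟨ cong₂ _+_ (T′₀≈0 (suc M)) (sumTo-cong M (λ n _ → trans (T′≈qT n (suc M)) (X^-⊛-shift 1 (T n) M))) ⟩
  0ℚ + sumPS T M
    ≡⟨ +-identityˡ (sumPS T M) ⟩
  sumPS T M
    ≡⟨ X^-⊛-shift 1 (sumPS T) M ⟨
  (X^ 1 ⊛ sumPS T) (suc M) ∎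
  where open ≡-Reasoning

-- q-Pochhammer symbols

Invertible-poch : ∀ a p n → 1 ≤ₒ a → Invertible (poch a p n)
Invertible-poch a p n 1≤a =
  Invertible-prodTo n _ (λ k → Invertible-1⊖ (a ⊛ (p ^ₚ k)) (≤ₒ-⊛ˡ a (p ^ₚ k) 1≤a))

inv-poch-suc : ∀ a p n → 1 ≤ₒ a → (onePS ⊖ a ⊛ (p ^ₚ n)) ⊛ inv (poch a p (suc n)) ≈ₚ inv (poch a p n)
inv-poch-suc a p n 1≤a =
  inv-prodTo-suc n _ (λ k → Invertible-1⊖ (a ⊛ (p ^ₚ k)) (≤ₒ-⊛ˡ a (p ^ₚ k) 1≤a))

poch-factor-X^ : ∀ a d k → onePS ⊖ X^ a ⊛ (X^ d ^ₚ k) ≈ₚ onePS ⊖ X^ (a ℕ.+ k ℕ.* d)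
poch-factor-X^ a d k = ⊖-cong (≈ₚ-refl {onePS}) (≈ₚ-trans (⊛-congˡ (X^ a) (X^-^ₚ d k)) (X^-⊛-X^ a (k ℕ.* d)))

poch-factor-⊝X^ : ∀ a d k → onePS ⊖ (⊝ X^ a) ⊛ (X^ d ^ₚ k) ≈ₚ onePS ⊕ X^ (a ℕ.+ k ℕ.* d)
poch-factor-⊝X^ a d k = ≈ₚ-trans
  (solve 2 (λ x y → con 1ℚ :- (:- x) :* y := con 1ℚ :+ x :* y) ≈ₚ-refl (X^ a) (X^ d ^ₚ k))
  (⊕-cong (≈ₚ-refl {onePS}) (≈ₚ-trans (⊛-congˡ (X^ a) (X^-^ₚ d k)) (X^-⊛-X^ a (k ℕ.* d))))
  where open PS-Solver using (solve; _:=_; _:+_; _:-_; _:*_; :-_; con)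

pochInf-coeff : ∀ a p → (∀ K → suc K ≤ₒ a ⊛ (p ^ₚ K)) → ∀ {c} n → c < n → poch a p n c ≡ pochInf a p c
pochInf-coeff a p ord {c} n c<n with ℕₚ.m≤n⇒m<n∨m≡n c<n
... | inj₂ refl = refl
pochInf-coeff a p ord {c} (suc n) _ | inj₁ (s≤s c<n) = begin
  (F ⊛ (onePS ⊖ g)) c           ≡⟨ ⊛-distribˡ F onePS (⊝ g) c ⟩
  (F ⊛ onePS) c + (F ⊛ ⊝ g) c   ≡⟨ cong₂ _+_ (⊛-identityʳ F c) F⊛⊝g≈0 ⟩
  F c + 0ℚ                      ≡⟨ +-identityʳ (F c) ⟩
  F c                           ≡⟨ pochInf-coeff a p ord n c<n ⟩
  pochInf a p c                 ∎
  where
  open ≡-Reasoning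
  F = poch a p n
  g = a ⊛ (p ^ₚ n)
  F⊛⊝g≈0 : (F ⊛ ⊝ g) c ≡ 0ℚ
  F⊛⊝g≈0 = ≤ₒ-⊛ʳ F (⊝ g) (≤ₒ-⊝ (ord n)) c (ℕₚ.<-trans c<n (ℕₚ.n<1+n n))

qPoch negqPoch q²Poch : ℕ → PS
qPoch    n = poch qq qq n
negqPoch n = poch (⊝ qq) qq n
q²Poch   n = poch (X^ 2) (X^ 2) n

qPoch⁻¹ : ℕ → PS
qPoch⁻¹ n = inv (qPoch n)

qPoch-factor : ∀ k → onePS ⊖ qq ⊛ (qq ^ₚ k) ≈ₚ onePS ⊖ X^ (suc k)
qPoch-factor k = ≈ₚ-trans (poch-factor-X^ 1 1 k) (⊖-cong (≈ₚ-refl {onePS}) (X^-cong (cong suc (ℕₚ.*-identityʳ k))))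

negqPoch-factor : ∀ k → onePS ⊖ (⊝ qq) ⊛ (qq ^ₚ k) ≈ₚ onePS ⊕ X^ (suc k)
negqPoch-factor k = ≈ₚ-trans (poch-factor-⊝X^ 1 1 k) (⊕-cong (≈ₚ-refl {onePS}) (X^-cong (cong suc (ℕₚ.*-identityʳ k))))

q²Poch-factor : ∀ k → onePS ⊖ X^ 2 ⊛ (X^ 2 ^ₚ k) ≈ₚ onePS ⊖ X^ (suc k ℕ.* 2)
q²Poch-factor k = poch-factor-X^ 2 2 k

Invertible-qPoch : ∀ n → Invertible (qPoch n)
Invertible-qPoch n = Invertible-poch qq qq n (1≤ₒ-X^suc 0)

Invertible-negqPoch : ∀ n → Invertible (negqPoch n)
Invertible-negqPoch n = Invertible-poch (⊝ qq) qq n (≤ₒ-⊝ (1≤ₒ-X^suc 0))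

inv-qPoch-suc : ∀ n → (onePS ⊖ X^ (suc n)) ⊛ qPoch⁻¹ (suc n) ≈ₚ qPoch⁻¹ n
inv-qPoch-suc n = ≈ₚ-trans (⊛-congʳ (qPoch⁻¹ (suc n)) (≈ₚ-sym (qPoch-factor n)))
                           (inv-poch-suc qq qq n (1≤ₒ-X^suc 0))

inv-q²Poch-suc : ∀ n → (onePS ⊖ X^ (suc n ℕ.* 2)) ⊛ inv (q²Poch (suc n)) ≈ₚ inv (q²Poch n)
inv-q²Poch-suc n = ≈ₚ-trans (⊛-congʳ (inv (q²Poch (suc n))) (≈ₚ-sym (q²Poch-factor n)))
                            (inv-poch-suc (X^ 2) (X^ 2) n (1≤ₒ-X^suc 1))

m+m≡m*2 : ∀ m → m ℕ.+ m ≡ m ℕ.* 2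
m+m≡m*2 m = trans (cong (m ℕ.+_) (sym (ℕₚ.+-identityʳ m))) (ℕₚ.*-comm 2 m)

negqPoch-⊛-qPoch : ∀ n → negqPoch n ⊛ qPoch n ≈ₚ q²Poch n
negqPoch-⊛-qPoch zero    = ⊛-identityˡ onePS
negqPoch-⊛-qPoch (suc n) = begin
  (negqPoch n ⊛ F) ⊛ (qPoch n ⊛ G)
    ≈⟨ solve 4 (λ a b c d → (a :* b) :* (c :* d) := (a :* c) :* (b :* d))
        ≈ₚ-refl (negqPoch n) F (qPoch n) G ⟩
  (negqPoch n ⊛ qPoch n) ⊛ (F ⊛ G)
    ≈⟨ ⊛-cong (negqPoch-⊛-qPoch n) (⊛-cong (negqPoch-factor n) (qPoch-factor n)) ⟩
  q²Poch n ⊛ ((onePS ⊕ x) ⊛ (onePS ⊖ x))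
    ≈⟨ ⊛-congˡ (q²Poch n) (solve 1 (λ x → (con 1ℚ :+ x) :* (con 1ℚ :- x) := con 1ℚ :- x :* x)
                                    ≈ₚ-refl x) ⟩
  q²Poch n ⊛ (onePS ⊖ x ⊛ x)
    ≈⟨ ⊛-congˡ (q²Poch n) (⊖-cong (≈ₚ-refl {onePS})
        (≈ₚ-trans (X^-⊛-X^ (suc n) (suc n)) (X^-cong (m+m≡m*2 (suc n))))) ⟩
  q²Poch n ⊛ (onePS ⊖ X^ (suc n ℕ.* 2))
    ≈⟨ ⊛-congˡ (q²Poch n) (q²Poch-factor n) ⟨
  q²Poch (suc n) ∎
  where
  open ≈ₚ-Reasoning
  open PS-Solver using (solve; _:=_; _:+_; _:-_; _:*_; con)
  F = onePS ⊖ (⊝ qq) ⊛ (qq ^ₚ n)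
  G = onePS ⊖ qq ⊛ (qq ^ₚ n)
  x = X^ (suc n)

-- 1/(-q;q)_{k-1}, including the case k = 0 where (-q;q)_{-1} = 1/2
negqPochInv : ℕ → PS
negqPochInv k = inv (pochℤ (⊝ qq) (ℤ.+ k ℤ.- ℤ.+ 1))

Invertible-pochℤ-negq : ∀ k → Invertible (pochℤ (⊝ qq) (ℤ.+ k ℤ.- ℤ.+ 1))
Invertible-pochℤ-negq zero    = Invertible-inv (prodTo 1 (λ k → onePS ⊖ shiftDown (⊝ qq) (suc k))) (λ ())
Invertible-pochℤ-negq (suc k) = Invertible-negqPoch k

negqPochInv-rec : ∀ k → negqPochInv k ≈ₚ negqPochInv (suc k) ⊛ (onePS ⊕ X^ k)
negqPochInv-rec zero = begin
  inv (inv half⁻¹)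
    ≈⟨ inv-unique (inv half⁻¹) half⁻¹ (Invertible-inv half⁻¹ (λ ())) (inv-⊛ half⁻¹ (λ ())) ⟩
  half⁻¹
    ≈⟨ half⁻¹≈2 ⟩
  onePS ⊕ X^ 0
    ≈⟨ ⊛-identityˡ (onePS ⊕ X^ 0) ⟨
  onePS ⊛ (onePS ⊕ X^ 0)
    ≈⟨ ⊛-congʳ (onePS ⊕ X^ 0) inv-one ⟨
  inv onePS ⊛ (onePS ⊕ X^ 0) ∎
  where
  open ≈ₚ-Reasoning
  half⁻¹ = prodTo 1 (λ k → onePS ⊖ shiftDown (⊝ qq) (suc k))
  factor≈2 : onePS ⊖ shiftDown (⊝ qq) 1 ≈ₚ onePS ⊕ X^ 0
  factor≈2 zero    = refl
  factor≈2 (suc N) rewrite ℕₚ.+-comm N 1 = refl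
  half⁻¹≈2 : half⁻¹ ≈ₚ onePS ⊕ X^ 0
  half⁻¹≈2 = ≈ₚ-trans (⊛-identityˡ (onePS ⊖ shiftDown (⊝ qq) 1)) factor≈2
negqPochInv-rec (suc k) = begin
  inv (negqPoch k)
    ≈⟨ inv-poch-suc (⊝ qq) qq k (≤ₒ-⊝ (1≤ₒ-X^suc 0)) ⟨
  (onePS ⊖ (⊝ qq) ⊛ (qq ^ₚ k)) ⊛ inv (negqPoch (suc k))
    ≈⟨ ⊛-congʳ (inv (negqPoch (suc k))) (negqPoch-factor k) ⟩
  (onePS ⊕ X^ (suc k)) ⊛ inv (negqPoch (suc k))
    ≈⟨ ⊛-comm (onePS ⊕ X^ (suc k)) (inv (negqPoch (suc k))) ⟩
  inv (negqPoch (suc k)) ⊛ (onePS ⊕ X^ (suc k)) ∎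
  where open ≈ₚ-Reasoning

lhsTerm : ℕ → ℕ → PS
lhsTerm m n = (sgn n · X^ n) ⊛ (negqPochInv (m ℕ.+ n) ⊛ qPoch⁻¹ n)

lhsSum : ℕ → PS
lhsSum m = sumPS (lhsTerm m)

lhs≈lhsSum : ∀ m → lhs m ≈ₚ lhsSum m
lhs≈lhsSum m = sumPS-cong (λ n →
  ⊛-congˡ (sgn n · X^ n) (inv-⊛-distrib (pochℤ (⊝ qq) (ℤ.+ (m ℕ.+ n) ℤ.- ℤ.+ 1)) (qPoch n)
                                        (Invertible-pochℤ-negq (m ℕ.+ n)) (Invertible-qPoch n)))

≤ₒ-lhsTerm : ∀ m n → n ≤ₒ lhsTerm m n
≤ₒ-lhsTerm m n = ≤ₒ-⊛ˡ (sgn n · X^ n) (negqPochInv (m ℕ.+ n) ⊛ qPoch⁻¹ n) (≤ₒ-· (sgn n) (X^ n) (≤ₒ-X^ n))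

lhsSumᵩ : ℕ → PS
lhsSumᵩ m = sumPS (λ n → X^ n ⊛ lhsTerm m n)

sgn-suc-X^ : ∀ k → sgn (suc k) · X^ (suc k) ≈ₚ ⊝ (X^ 1 ⊛ (sgn k · X^ k))
sgn-suc-X^ k N = trans (sym (neg-distribˡ-* (sgn k) (X^ (suc k) N)))
                       (cong -_ (sym (trans (⊛-· (X^ 1) (sgn k) (X^ k) N) (cong (sgn k *_) (X^-⊛-X^ 1 k N)))))

lhsTerm-split : ∀ m n → lhsTerm m n ≈ₚ lhsTerm (suc m) n ⊕ X^ m ⊛ (X^ n ⊛ lhsTerm (suc m) n)
lhsTerm-split m n = begin
  s ⊛ (negqPochInv (m ℕ.+ n) ⊛ i)
    ≈⟨ ⊛-congˡ s (⊛-congʳ i (negqPochInv-rec (m ℕ.+ n))) ⟩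
  s ⊛ ((e ⊛ (onePS ⊕ X^ (m ℕ.+ n))) ⊛ i)
    ≈⟨ ⊛-congˡ s (⊛-congʳ i (⊛-congˡ e (⊕-cong (≈ₚ-refl {onePS}) (≈ₚ-sym (X^-⊛-X^ m n))))) ⟩
  s ⊛ ((e ⊛ (onePS ⊕ X^ m ⊛ X^ n)) ⊛ i)
    ≈⟨ solve 5 (λ s e i x y → s :* ((e :* (con 1ℚ :+ x :* y)) :* i)
               := s :* (e :* i) :+ x :* (y :* (s :* (e :* i))))
        ≈ₚ-refl s e i (X^ m) (X^ n) ⟩
  lhsTerm (suc m) n ⊕ X^ m ⊛ (X^ n ⊛ lhsTerm (suc m) n) ∎
  where
  open ≈ₚ-Reasoning
  open PS-Solver using (solve; _:=_; _:+_; _:*_; con)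
  s = sgn n · X^ n
  e = negqPochInv (suc (m ℕ.+ n))
  i = qPoch⁻¹ n

lhsTerm-shift : ∀ m k → lhsTerm m (suc k) ⊖ X^ (suc k) ⊛ lhsTerm m (suc k) ≈ₚ X^ 1 ⊛ (⊝ lhsTerm (suc m) k)
lhsTerm-shift m k = begin
  s′ ⊛ (e ⊛ i′) ⊖ X^ (suc k) ⊛ (s′ ⊛ (e ⊛ i′))
    ≈⟨ solve 4 (λ s e i x → s :* (e :* i) :- x :* (s :* (e :* i))
                 := s :* (e :* ((con 1ℚ :- x) :* i)))
        ≈ₚ-refl s′ e i′ (X^ (suc k)) ⟩
  s′ ⊛ (e ⊛ ((onePS ⊖ X^ (suc k)) ⊛ i′))
    ≈⟨ ⊛-cong (sgn-suc-X^ k) (⊛-cong (negqPochInv-cong (ℕₚ.+-suc m k)) (inv-qPoch-suc k)) ⟩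
  (⊝ (X^ 1 ⊛ s)) ⊛ (negqPochInv (suc m ℕ.+ k) ⊛ qPoch⁻¹ k)
    ≈⟨ solve 3 (λ x s t → (:- (x :* s)) :* t := x :* (:- (s :* t)))
        ≈ₚ-refl (X^ 1) s (negqPochInv (suc m ℕ.+ k) ⊛ qPoch⁻¹ k) ⟩
  X^ 1 ⊛ (⊝ lhsTerm (suc m) k) ∎
  where
  open ≈ₚ-Reasoning
  open PS-Solver using (solve; _:=_; _:-_; _:*_; :-_; con)
  s′ = sgn (suc k) · X^ (suc k)
  s  = sgn k · X^ k
  e  = negqPochInv (m ℕ.+ suc k)
  i′ = qPoch⁻¹ (suc k)
  negqPochInv-cong : ∀ {a b} → a ≡ b → negqPochInv a ≈ₚ negqPochInv b
  negqPochInv-cong refl = ≈ₚ-refl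

lhsSum-split : ∀ m → lhsSum m ≈ₚ lhsSum (suc m) ⊕ X^ m ⊛ lhsSumᵩ (suc m)
lhsSum-split m = begin
  lhsSum m
    ≈⟨ sumPS-cong (lhsTerm-split m) ⟩
  sumPS (λ n → lhsTerm (suc m) n ⊕ X^ m ⊛ (X^ n ⊛ lhsTerm (suc m) n))
    ≈⟨ sumPS-⊕ (lhsTerm (suc m)) _ ⟩
  lhsSum (suc m) ⊕ sumPS (λ n → X^ m ⊛ (X^ n ⊛ lhsTerm (suc m) n))
    ≈⟨ ⊕-cong (≈ₚ-refl {lhsSum (suc m)}) (sumPS-X^-⊛ m _ (λ n → ≤ₒ-⊛ʳ (X^ n) _ (≤ₒ-lhsTerm (suc m) n))) ⟩
  lhsSum (suc m) ⊕ X^ m ⊛ lhsSumᵩ (suc m) ∎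
  where open ≈ₚ-Reasoning

lhsSum-shift : ∀ m → lhsSum m ⊖ lhsSumᵩ m ≈ₚ X^ 1 ⊛ (⊝ lhsSum (suc m))
lhsSum-shift m = begin
  lhsSum m ⊖ lhsSumᵩ m
    ≈⟨ sumPS-⊖ (lhsTerm m) _ ⟨
  sumPS (λ n → lhsTerm m n ⊖ X^ n ⊛ lhsTerm m n)
    ≈⟨ sumPS-shift _ (λ k → ⊝ lhsTerm (suc m) k) vanishes₀ (lhsTerm-shift m) ⟩
  X^ 1 ⊛ sumPS (λ k → ⊝ lhsTerm (suc m) k)
    ≈⟨ ⊛-congˡ (X^ 1) (sumPS-⊝ (lhsTerm (suc m))) ⟩
  X^ 1 ⊛ (⊝ lhsSum (suc m)) ∎
  where
  open ≈ₚ-Reasoning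
  vanishes₀ : lhsTerm m 0 ⊖ X^ 0 ⊛ lhsTerm m 0 ≈ₚ zeroPS
  vanishes₀ = ≈ₚ-trans (⊖-cong (≈ₚ-refl {lhsTerm m 0}) (≈ₚ-trans (⊛-congʳ (lhsTerm m 0) X^-zero) (⊛-identityˡ (lhsTerm m 0))))
                       (λ N → +-inverseʳ (lhsTerm m 0 N))

lhsSumᵩ≈lhsSum : ∀ m → lhsSumᵩ m ≈ₚ lhsSum m ⊕ X^ 1 ⊛ lhsSum (suc m)
lhsSumᵩ≈lhsSum m = begin
  lhsSumᵩ m                     ≈⟨ solve 2 (λ u s → u := s :- (s :- u)) ≈ₚ-refl (lhsSumᵩ m) (lhsSum m) ⟩
  s₀ ⊖ (s₀ ⊖ lhsSumᵩ m)         ≈⟨ ⊖-cong (≈ₚ-refl {s₀}) (lhsSum-shift m) ⟩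
  s₀ ⊖ X^ 1 ⊛ (⊝ s₁)            ≈⟨ solve 3 (λ s x t → s :- x :* (:- t) := s :+ x :* t) ≈ₚ-refl s₀ (X^ 1) s₁ ⟩
  s₀ ⊕ X^ 1 ⊛ s₁                ∎
  where
  open ≈ₚ-Reasoning
  open PS-Solver using (solve; _:=_; _:+_; _:-_; _:*_; :-_)
  s₀ = lhsSum m
  s₁ = lhsSum (suc m)

lhsSum-rec : ∀ m → lhsSum m ≈ₚ lhsSum (suc m) ⊕ X^ m ⊛ lhsSum (suc m) ⊕ X^ m ⊛ (X^ 1 ⊛ lhsSum (suc (suc m)))
lhsSum-rec m = begin
  lhsSum m                               ≈⟨ lhsSum-split m ⟩
  s₁ ⊕ X^ m ⊛ lhsSumᵩ (suc m)            ≈⟨ ⊕-cong (≈ₚ-refl {s₁}) (⊛-congˡ (X^ m) (lhsSumᵩ≈lhsSum (suc m))) ⟩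
  s₁ ⊕ X^ m ⊛ (s₁ ⊕ X^ 1 ⊛ s₂)           ≈⟨ solve 4 (λ s t x y → s :+ x :* (s :+ y :* t) := s :+ x :* s :+ x :* (y :* t))
                                                   ≈ₚ-refl s₁ s₂ (X^ m) (X^ 1) ⟩
  s₁ ⊕ X^ m ⊛ s₁ ⊕ X^ m ⊛ (X^ 1 ⊛ s₂)    ∎
  where
  open ≈ₚ-Reasoning
  open PS-Solver using (solve; _:=_; _:+_; _:*_)
  s₁ = lhsSum (suc m)
  s₂ = lhsSum (suc (suc m))

-- Euler's identity  Σₙ (-1)ⁿ q^{nj} / (q²;q²)ₙ = 1 / (-q^j;q²)_∞

eulerTerm : ℕ → ℕ → PS
eulerTerm j n = (sgn n · X^ (n ℕ.* j)) ⊛ inv (q²Poch n)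

euler : ℕ → PS
euler j = sumPS (eulerTerm j)

euler-cong : ∀ {i j} → i ≡ j → euler i ≈ₚ euler j
euler-cong refl = ≈ₚ-refl

≤ₒ-eulerTerm : ∀ j n → n ℕ.* j ≤ₒ eulerTerm j n
≤ₒ-eulerTerm j n = ≤ₒ-⊛ˡ (sgn n · X^ (n ℕ.* j)) (inv (q²Poch n)) (≤ₒ-· (sgn n) (X^ (n ℕ.* j)) (≤ₒ-X^ (n ℕ.* j)))

eulerTerm-zero : ∀ j → eulerTerm j 0 ≈ₚ onePS
eulerTerm-zero j = ≈ₚ-trans (⊛-cong (λ N → trans (*-identityˡ (X^ 0 N)) (X^-zero N)) inv-one) (⊛-identityˡ onePS)

eulerTerm-diff : ∀ j k → eulerTerm j (suc k) ⊖ eulerTerm (suc (suc j)) (suc k) ≈ₚ X^ j ⊛ (⊝ eulerTerm j k)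
eulerTerm-diff j k = begin
  (sgn (suc k) · A) ⊛ I₁ ⊖ (sgn (suc k) · X^ (suc k ℕ.* suc (suc j))) ⊛ I₁
    ≈⟨ ⊖-cong (⊛-congʳ I₁ (·-as-⊛ (sgn (suc k)) A))
              (⊛-congʳ I₁ (≈ₚ-trans (·-as-⊛ (sgn (suc k)) _) (⊛-congˡ (cst (sgn (suc k))) exponent))) ⟩
  (c ⊛ A) ⊛ I₁ ⊖ (c ⊛ (A ⊛ Y)) ⊛ I₁
    ≈⟨ solve 4 (λ c a y i → (c :* a) :* i :- (c :* (a :* y)) :* i := (c :* a) :* ((con 1ℚ :- y) :* i)) ≈ₚ-refl c A Y I₁ ⟩
  (c ⊛ A) ⊛ ((onePS ⊖ Y) ⊛ I₁)
    ≈⟨ ⊛-cong (⊛-cong (cst-neg (sgn k)) (≈ₚ-sym (X^-⊛-X^ j (k ℕ.* j)))) (inv-q²Poch-suc k) ⟩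
  ((⊝ cst (sgn k)) ⊛ (X^ j ⊛ X^ (k ℕ.* j))) ⊛ inv (q²Poch k)
    ≈⟨ solve 4 (λ c x y i → ((:- c) :* (x :* y)) :* i := x :* (:- ((c :* y) :* i)))
               ≈ₚ-refl (cst (sgn k)) (X^ j) (X^ (k ℕ.* j)) (inv (q²Poch k)) ⟩
  X^ j ⊛ (⊝ ((cst (sgn k) ⊛ X^ (k ℕ.* j)) ⊛ inv (q²Poch k)))
    ≈⟨ ⊛-congˡ (X^ j) (⊝-cong (⊛-congʳ (inv (q²Poch k)) (·-as-⊛ (sgn k) (X^ (k ℕ.* j))))) ⟨
  X^ j ⊛ (⊝ eulerTerm j k) ∎
  where
  open ≈ₚ-Reasoning
  open PS-Solver using (solve; _:=_; _:-_; _:*_; :-_; con)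
  A  = X^ (suc k ℕ.* j)
  Y  = X^ (suc k ℕ.* 2)
  c  = cst (sgn (suc k))
  I₁ = inv (q²Poch (suc k))
  exponent : X^ (suc k ℕ.* suc (suc j)) ≈ₚ A ⊛ Y
  exponent = ≈ₚ-trans (X^-cong (trans (cong (suc k ℕ.*_) (ℕₚ.+-comm 2 j)) (ℕₚ.*-distribˡ-+ (suc k) j 2)))
                      (≈ₚ-sym (X^-⊛-X^ (suc k ℕ.* j) (suc k ℕ.* 2)))

euler-rec : ∀ b → euler (suc (suc (suc b))) ≈ₚ euler (suc b) ⊕ X^ (suc b) ⊛ euler (suc b)
euler-rec b = begin
  E″
    ≈⟨ solve 2 (λ e e″ → e″ := e :- (e :- e″)) ≈ₚ-refl E E″ ⟩
  E ⊖ (E ⊖ E″)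
    ≈⟨ ⊖-cong (≈ₚ-refl {E}) difference ⟩
  E ⊖ X^ (suc b) ⊛ (⊝ E)
    ≈⟨ solve 2 (λ e x → e :- x :* (:- e) := e :+ x :* e) ≈ₚ-refl E (X^ (suc b)) ⟩
  E ⊕ X^ (suc b) ⊛ E ∎
  where
  open ≈ₚ-Reasoning
  open PS-Solver using (solve; _:=_; _:+_; _:-_; _:*_; :-_)
  j  = suc b
  E  = euler j
  E″ = euler (suc (suc j))
  ≤ₒ-⊝eulerTerm : ∀ n → n ≤ₒ ⊝ eulerTerm j n
  ≤ₒ-⊝eulerTerm n = ≤ₒ-⊝ (≤ₒ-weaken (ℕₚ.m≤m*n n j) (≤ₒ-eulerTerm j n))
  difference : E ⊖ E″ ≈ₚ X^ j ⊛ (⊝ E)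
  difference = begin
    E ⊖ E″
      ≈⟨ sumPS-⊖ (eulerTerm j) (eulerTerm (suc (suc j))) ⟨
    sumPS (λ n → eulerTerm j n ⊖ eulerTerm (suc (suc j)) n)
      ≈⟨ sumPS-shift _ (λ n → X^ b ⊛ (⊝ eulerTerm j n)) (λ N → +-inverseʳ (eulerTerm j 0 N))
                     (λ n → ≈ₚ-trans (eulerTerm-diff j n) (≈ₚ-sym (X^-⊛-X^-⊛ 1 b (⊝ eulerTerm j n)))) ⟩
    X^ 1 ⊛ sumPS (λ n → X^ b ⊛ (⊝ eulerTerm j n))
      ≈⟨ ⊛-congˡ (X^ 1) (sumPS-X^-⊛ b _ ≤ₒ-⊝eulerTerm) ⟩
    X^ 1 ⊛ (X^ b ⊛ sumPS (λ n → ⊝ eulerTerm j n))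
      ≈⟨ X^-⊛-X^-⊛ 1 b (sumPS (λ n → ⊝ eulerTerm j n)) ⟩
    X^ j ⊛ sumPS (λ n → ⊝ eulerTerm j n)
      ≈⟨ ⊛-congˡ (X^ j) (sumPS-⊝ (eulerTerm j)) ⟩
    X^ j ⊛ (⊝ E) ∎

euler-⊛-poch : ∀ b K → euler (suc b) ⊛ poch (⊝ X^ (suc b)) (X^ 2) K ≈ₚ euler (suc b ℕ.+ K ℕ.* 2)
euler-⊛-poch b zero    = ≈ₚ-trans (⊛-identityʳ (euler (suc b))) (euler-cong (sym (ℕₚ.+-identityʳ (suc b))))
euler-⊛-poch b (suc K) = begin
  euler (suc b) ⊛ (poch a (X^ 2) K ⊛ (onePS ⊖ a ⊛ (X^ 2 ^ₚ K)))
    ≈⟨ ⊛-assoc (euler (suc b)) (poch a (X^ 2) K) (onePS ⊖ a ⊛ (X^ 2 ^ₚ K)) ⟨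
  (euler (suc b) ⊛ poch a (X^ 2) K) ⊛ (onePS ⊖ a ⊛ (X^ 2 ^ₚ K))
    ≈⟨ ⊛-cong (euler-⊛-poch b K) (poch-factor-⊝X^ (suc b) 2 K) ⟩
  euler j ⊛ (onePS ⊕ X^ j)
    ≈⟨ solve 2 (λ e x → e :* (con 1ℚ :+ x) := e :+ x :* e) ≈ₚ-refl (euler j) (X^ j) ⟩
  euler j ⊕ X^ j ⊛ euler j
    ≈⟨ euler-rec (b ℕ.+ K ℕ.* 2) ⟨
  euler (suc (suc j))
    ≈⟨ euler-cong (sym (trans (ℕₚ.+-suc (suc b) (suc (K ℕ.* 2))) (cong suc (ℕₚ.+-suc (suc b) (K ℕ.* 2))))) ⟩
  euler (suc b ℕ.+ suc K ℕ.* 2) ∎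
  where
  open ≈ₚ-Reasoning
  open PS-Solver using (solve; _:=_; _:+_; _:*_; con)
  a = ⊝ X^ (suc b)
  j = suc b ℕ.+ K ℕ.* 2

euler-low : ∀ j N → N < j → euler j N ≡ onePS N
euler-low j zero    N<j = eulerTerm-zero j 0
euler-low j (suc N) N<j = begin
  sumTo (suc N) (λ n → eulerTerm j n (suc N))
    ≡⟨ sumTo-suc N _ ⟩
  eulerTerm j 0 (suc N) + sumTo N (λ n → eulerTerm j (suc n) (suc N))
    ≡⟨ cong₂ _+_ (eulerTerm-zero j (suc N)) (sumTo-zero N _ high) ⟩
  0ℚ + 0ℚ
    ≡⟨ +-identityʳ 0ℚ ⟩
  0ℚ ∎
  where
  open ≡-Reasoning
  high : ∀ n → n ≤ N → eulerTerm j (suc n) (suc N) ≡ 0ℚ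
  high n _ = ≤ₒ-eulerTerm j (suc n) (suc N) (ℕₚ.<-≤-trans N<j (ℕₚ.m≤m+n j (n ℕ.* j)))

-- Multiplying by the factors 1 + q^{j+2K} of (-q^j;q²)_∞ one at a time raises j by 2 (euler-rec),
-- and euler j agrees with 1 below degree j.
euler-identity : ∀ b → euler (suc b) ≈ₚ inv (pochInf (⊝ X^ (suc b)) (X^ 2))
euler-identity b = ≈ₚ-sym (inv-unique P∞ (euler (suc b)) P∞-invertible (≈ₚ-trans (⊛-comm P∞ (euler (suc b))) E⊛P∞≈1))
  where
  a  = ⊝ X^ (suc b)
  P∞ = pochInf a (X^ 2)
  P∞-invertible : Invertible P∞
  P∞-invertible = Invertible-poch a (X^ 2) 1 (≤ₒ-⊝ (1≤ₒ-X^suc b))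
  ord : ∀ K → suc K ≤ₒ a ⊛ (X^ 2 ^ₚ K)
  ord K = ≤ₒ-weaken (s≤s (ℕₚ.≤-trans (ℕₚ.m≤m*n K 2) (ℕₚ.m≤n+m (K ℕ.* 2) b)))
                    (≤ₒ-⊛ a (X^ 2 ^ₚ K) (≤ₒ-⊝ (≤ₒ-X^ (suc b))) (≤ₒ-cong (≈ₚ-sym (X^-^ₚ 2 K)) (≤ₒ-X^ (K ℕ.* 2))))
  E⊛P∞≈1 : euler (suc b) ⊛ P∞ ≈ₚ onePS
  E⊛P∞≈1 N = begin
    sumTo N (λ i → euler (suc b) i * P∞ (N ∸ i))
      ≡⟨ sumTo-cong N (λ i i≤N → cong (euler (suc b) i *_) (sym (pochInf-coeff a (X^ 2) ord (suc N) (s≤s (ℕₚ.m∸n≤m N i))))) ⟩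
    (euler (suc b) ⊛ poch a (X^ 2) (suc N)) N
      ≡⟨ euler-⊛-poch b (suc N) N ⟩
    euler (suc b ℕ.+ suc N ℕ.* 2) N
      ≡⟨ euler-low _ N (s≤s (ℕₚ.≤-trans (ℕₚ.≤-trans (ℕₚ.n≤1+n N) (ℕₚ.m≤m*n (suc N) 2)) (ℕₚ.m≤n+m (suc N ℕ.* 2) b))) ⟩
    onePS N ∎
    where open ≡-Reasoning

negqPochInv-⊛-inv-qPoch : ∀ n → negqPochInv (suc n) ⊛ qPoch⁻¹ n ≈ₚ inv (q²Poch n)
negqPochInv-⊛-inv-qPoch n =
  ≈ₚ-trans (≈ₚ-sym (inv-⊛-distrib (negqPoch n) (qPoch n) (Invertible-negqPoch n) (Invertible-qPoch n)))
           (inv-cong (negqPoch-⊛-qPoch n))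

A∞ B∞ : PS
A∞ = inv (pochInf (⊝ qq) (X^ 2))
B∞ = inv (pochInf (⊝ X^ 2) (X^ 2))

lhsSum-one : lhsSum 1 ≈ₚ A∞
lhsSum-one = ≈ₚ-trans (sumPS-cong term) (euler-identity 0)
  where
  term : ∀ n → lhsTerm 1 n ≈ₚ eulerTerm 1 n
  term n = ⊛-cong (λ N → cong (λ k → sgn n * X^ k N) (sym (ℕₚ.*-identityʳ n))) (negqPochInv-⊛-inv-qPoch n)

lhsSumᵩ-one : lhsSumᵩ 1 ≈ₚ B∞
lhsSumᵩ-one = ≈ₚ-trans (sumPS-cong term) (euler-identity 1)
  where
  term : ∀ n → X^ n ⊛ lhsTerm 1 n ≈ₚ eulerTerm 2 n
  term n = begin
    X^ n ⊛ ((sgn n · X^ n) ⊛ (negqPochInv (suc n) ⊛ qPoch⁻¹ n))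
      ≈⟨ ⊛-assoc (X^ n) (sgn n · X^ n) (negqPochInv (suc n) ⊛ qPoch⁻¹ n) ⟨
    (X^ n ⊛ (sgn n · X^ n)) ⊛ (negqPochInv (suc n) ⊛ qPoch⁻¹ n)
      ≈⟨ ⊛-cong (≈ₚ-trans (⊛-· (X^ n) (sgn n) (X^ n)) (λ N → cong (sgn n *_) (≈ₚ-trans (X^-⊛-X^ n n) (X^-cong (m+m≡m*2 n)) N)))
                (negqPochInv-⊛-inv-qPoch n) ⟩
    eulerTerm 2 n ∎
    where open ≈ₚ-Reasoning

lhsSum-zero : lhsSum 0 ≈ₚ A∞ ⊕ B∞
lhsSum-zero = ≈ₚ-trans (lhsSum-split 0)
                       (⊕-cong lhsSum-one (≈ₚ-trans (⊛-congʳ (lhsSumᵩ 1) X^-zero)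
                                                   (≈ₚ-trans (⊛-identityˡ (lhsSumᵩ 1)) lhsSumᵩ-one)))

-- Trinomial coefficients

gauss-≤ : ∀ {N M} → M ≤ N → gauss (ℤ.+ N) M ≡ qPoch N ⊛ inv (qPoch M ⊛ qPoch (N ∸ M))
gauss-≤ M≤N rewrite ≤ᵇ-true M≤N = refl

gauss-> : ∀ {N M} → N < M → gauss (ℤ.+ N) M ≈ₚ zeroPS
gauss-> N<M rewrite ≤ᵇ-false (ℕₚ.<⇒≱ N<M) = ≈ₚ-refl

qPoch-cong : ∀ {a b} → a ≡ b → qPoch a ≈ₚ qPoch b
qPoch-cong refl = ≈ₚ-refl

trinomial : ℕ → ℕ → ℕ → PS
trinomial i j k = qPoch (i ℕ.+ j ℕ.+ k) ⊛ (qPoch⁻¹ i ⊛ qPoch⁻¹ j ⊛ qPoch⁻¹ k)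

trinomial-zero : trinomial 0 0 0 ≈ₚ onePS
trinomial-zero = begin
  onePS ⊛ (qPoch⁻¹ 0 ⊛ qPoch⁻¹ 0 ⊛ qPoch⁻¹ 0)
    ≈⟨ ⊛-identityˡ _ ⟩
  qPoch⁻¹ 0 ⊛ qPoch⁻¹ 0 ⊛ qPoch⁻¹ 0
    ≈⟨ ⊛-cong (⊛-cong inv-one inv-one) inv-one ⟩
  onePS ⊛ onePS ⊛ onePS
    ≈⟨ ≈ₚ-trans (⊛-congʳ onePS (⊛-identityˡ onePS)) (⊛-identityˡ onePS) ⟩
  onePS ∎
  where open ≈ₚ-Reasoning

gauss-⊛-gauss : ∀ i j k → gauss (ℤ.+ (i ℕ.+ j ℕ.+ k)) (i ℕ.+ j) ⊛ gauss (ℤ.+ (i ℕ.+ j)) i ≈ₚ trinomial i j k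
gauss-⊛-gauss i j k
  rewrite gauss-≤ (ℕₚ.m≤m+n (i ℕ.+ j) k) | gauss-≤ (ℕₚ.m≤m+n i j)
        | ℕₚ.m+n∸m≡n (i ℕ.+ j) k | ℕₚ.m+n∸m≡n i j = begin
  (qPoch N ⊛ inv (qPoch n ⊛ qPoch k)) ⊛ (qPoch n ⊛ inv (qPoch i ⊛ qPoch j))
    ≈⟨ ⊛-cong (⊛-congˡ (qPoch N) (inv-⊛-distrib (qPoch n) (qPoch k) (Invertible-qPoch n) (Invertible-qPoch k)))
              (⊛-congˡ (qPoch n) (inv-⊛-distrib (qPoch i) (qPoch j) (Invertible-qPoch i) (Invertible-qPoch j))) ⟩
  (qPoch N ⊛ (qPoch⁻¹ n ⊛ qPoch⁻¹ k)) ⊛ (qPoch n ⊛ (qPoch⁻¹ i ⊛ qPoch⁻¹ j))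
    ≈⟨ solve 6 (λ pN pn an ak ai aj → (pN :* (an :* ak)) :* (pn :* (ai :* aj)) := (pN :* (ai :* aj :* ak)) :* (an :* pn))
               ≈ₚ-refl (qPoch N) (qPoch n) (qPoch⁻¹ n) (qPoch⁻¹ k) (qPoch⁻¹ i) (qPoch⁻¹ j) ⟩
  trinomial i j k ⊛ (qPoch⁻¹ n ⊛ qPoch n)
    ≈⟨ ⊛-congˡ (trinomial i j k) (inv-⊛ (qPoch n) (Invertible-qPoch n)) ⟩
  trinomial i j k ⊛ onePS
    ≈⟨ ⊛-identityʳ (trinomial i j k) ⟩
  trinomial i j k ∎
  where
  open ≈ₚ-Reasoning
  open PS-Solver using (solve; _:=_; _:*_)
  N = i ℕ.+ j ℕ.+ k
  n = i ℕ.+ j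

-- 1/(q;q)_{k-1}, which vanishes for k = 0
qPoch⁻¹-pred : ℕ → PS
qPoch⁻¹-pred k = (onePS ⊖ X^ k) ⊛ qPoch⁻¹ k

qPoch⁻¹-pred-zero : qPoch⁻¹-pred 0 ≈ₚ zeroPS
qPoch⁻¹-pred-zero = ⊛-absorbˡ (qPoch⁻¹ 0) one⊖X^0≈0

qPoch⁻¹-pred-suc : ∀ k → qPoch⁻¹-pred (suc k) ≈ₚ qPoch⁻¹ k
qPoch⁻¹-pred-suc = inv-qPoch-suc

-- The trinomial coefficient with k, j or i lowered by one (zero when that index is 0)
trinomialₖ⁻ trinomialⱼ⁻ trinomialᵢ⁻ : ℕ → ℕ → ℕ → PS
trinomialₖ⁻ i j k = qPoch (i ℕ.+ j ℕ.+ k ∸ 1) ⊛ (qPoch⁻¹ i ⊛ qPoch⁻¹ j ⊛ qPoch⁻¹-pred k)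
trinomialⱼ⁻ i j k = qPoch (i ℕ.+ j ℕ.+ k ∸ 1) ⊛ (qPoch⁻¹ i ⊛ qPoch⁻¹-pred j ⊛ qPoch⁻¹ k)
trinomialᵢ⁻ i j k = qPoch (i ℕ.+ j ℕ.+ k ∸ 1) ⊛ (qPoch⁻¹-pred i ⊛ qPoch⁻¹ j ⊛ qPoch⁻¹ k)

trinomialₖ⁻-zero : ∀ i j → trinomialₖ⁻ i j 0 ≈ₚ zeroPS
trinomialₖ⁻-zero i j = ⊛-absorbʳ (qPoch (i ℕ.+ j ℕ.+ 0 ∸ 1)) (⊛-absorbʳ (qPoch⁻¹ i ⊛ qPoch⁻¹ j) qPoch⁻¹-pred-zero)

trinomialⱼ⁻-zero : ∀ i k → trinomialⱼ⁻ i 0 k ≈ₚ zeroPS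
trinomialⱼ⁻-zero i k =
  ⊛-absorbʳ (qPoch (i ℕ.+ 0 ℕ.+ k ∸ 1)) (⊛-absorbˡ (qPoch⁻¹ k) (⊛-absorbʳ (qPoch⁻¹ i) qPoch⁻¹-pred-zero))

trinomialᵢ⁻-zero : ∀ j k → trinomialᵢ⁻ 0 j k ≈ₚ zeroPS
trinomialᵢ⁻-zero j k =
  ⊛-absorbʳ (qPoch (j ℕ.+ k ∸ 1)) (⊛-absorbˡ (qPoch⁻¹ k) (⊛-absorbˡ (qPoch⁻¹ j) qPoch⁻¹-pred-zero))

trinomialₖ⁻-suc : ∀ i j k → trinomialₖ⁻ i j (suc k) ≈ₚ trinomial i j k
trinomialₖ⁻-suc i j k = ⊛-cong (qPoch-cong (cong (ℕ._∸ 1) (ℕₚ.+-suc (i ℕ.+ j) k)))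
                               (⊛-congˡ (qPoch⁻¹ i ⊛ qPoch⁻¹ j) (qPoch⁻¹-pred-suc k))

trinomialⱼ⁻-suc : ∀ i j k → trinomialⱼ⁻ i (suc j) k ≈ₚ trinomial i j k
trinomialⱼ⁻-suc i j k = ⊛-cong (qPoch-cong (cong (λ n → n ℕ.+ k ∸ 1) (ℕₚ.+-suc i j)))
                               (⊛-congʳ (qPoch⁻¹ k) (⊛-congˡ (qPoch⁻¹ i) (qPoch⁻¹-pred-suc j)))

trinomialᵢ⁻-suc : ∀ i j k → trinomialᵢ⁻ (suc i) j k ≈ₚ trinomial i j k
trinomialᵢ⁻-suc i j k = ⊛-congˡ (qPoch (i ℕ.+ j ℕ.+ k)) (⊛-congʳ (qPoch⁻¹ k) (⊛-congʳ (qPoch⁻¹ j) (qPoch⁻¹-pred-suc i)))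

-- q-Pascal: split 1 - q^{i+j+k} = (1 - q^k) + q^k (1 - q^j) + q^{j+k} (1 - q^i)
trinomial-pascal : ∀ i j k n → i ℕ.+ j ℕ.+ k ≡ suc n →
                   trinomial i j k ≈ₚ trinomialₖ⁻ i j k ⊕ X^ k ⊛ trinomialⱼ⁻ i j k ⊕ X^ (j ℕ.+ k) ⊛ trinomialᵢ⁻ i j k
trinomial-pascal i j k n i+j+k≡1+n = begin
  qPoch (i ℕ.+ j ℕ.+ k) ⊛ (ai ⊛ aj ⊛ ak)
    ≈⟨ ⊛-congʳ (ai ⊛ aj ⊛ ak) (≈ₚ-trans (qPoch-cong i+j+k≡1+n) (⊛-congˡ (qPoch n) (qPoch-factor n))) ⟩
  (qPoch n ⊛ (onePS ⊖ X^ (suc n))) ⊛ (ai ⊛ aj ⊛ ak)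
    ≈⟨ ⊛-congʳ (ai ⊛ aj ⊛ ak) (⊛-congˡ (qPoch n) (⊖-cong (≈ₚ-refl {onePS})
         (≈ₚ-trans (X^-cong (sym i+j+k≡1+n)) (≈ₚ-trans (≈ₚ-sym (X^-⊛-X^ (i ℕ.+ j) k)) (⊛-congʳ (X^ k) (≈ₚ-sym (X^-⊛-X^ i j))))))) ⟩
  (qPoch n ⊛ (onePS ⊖ X^ i ⊛ X^ j ⊛ X^ k)) ⊛ (ai ⊛ aj ⊛ ak)
    ≈⟨ solve 7 (λ p x y z a b c →
          (p :* (con 1ℚ :- x :* y :* z)) :* (a :* b :* c)
       := p :* (a :* b :* ((con 1ℚ :- z) :* c)) :+ z :* (p :* (a :* ((con 1ℚ :- y) :* b) :* c))
          :+ (y :* z) :* (p :* ((con 1ℚ :- x) :* a :* b :* c)))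
       ≈ₚ-refl (qPoch n) (X^ i) (X^ j) (X^ k) ai aj ak ⟩
  qPoch n ⊛ (ai ⊛ aj ⊛ qPoch⁻¹-pred k) ⊕ X^ k ⊛ (qPoch n ⊛ (ai ⊛ qPoch⁻¹-pred j ⊛ ak))
    ⊕ (X^ j ⊛ X^ k) ⊛ (qPoch n ⊛ (qPoch⁻¹-pred i ⊛ aj ⊛ ak))
    ≈⟨ ⊕-cong (⊕-cong (⊛-congʳ (ai ⊛ aj ⊛ qPoch⁻¹-pred k) n≈) (⊛-congˡ (X^ k) (⊛-congʳ (ai ⊛ qPoch⁻¹-pred j ⊛ ak) n≈)))
              (⊛-cong (X^-⊛-X^ j k) (⊛-congʳ (qPoch⁻¹-pred i ⊛ aj ⊛ ak) n≈)) ⟩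
  trinomialₖ⁻ i j k ⊕ X^ k ⊛ trinomialⱼ⁻ i j k ⊕ X^ (j ℕ.+ k) ⊛ trinomialᵢ⁻ i j k ∎
  where
  open ≈ₚ-Reasoning
  open PS-Solver using (solve; _:=_; _:+_; _:-_; _:*_; con)
  ai = qPoch⁻¹ i
  aj = qPoch⁻¹ j
  ak = qPoch⁻¹ k
  n≈ : qPoch n ≈ₚ qPoch (i ℕ.+ j ℕ.+ k ∸ 1)
  n≈ = qPoch-cong (cong (ℕ._∸ 1) (sym i+j+k≡1+n))

trinomial-sucᵢ : ∀ i j k → (onePS ⊖ X^ (suc i)) ⊛ trinomial (suc i) j k ≈ₚ (onePS ⊖ X^ (suc (i ℕ.+ j ℕ.+ k))) ⊛ trinomial i j k
trinomial-sucᵢ i j k = begin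
  y ⊛ (qPoch (suc N) ⊛ (qPoch⁻¹ (suc i) ⊛ aj ⊛ ak))
    ≈⟨ ⊛-congˡ y (⊛-congʳ (qPoch⁻¹ (suc i) ⊛ aj ⊛ ak) (⊛-congˡ (qPoch N) (qPoch-factor N))) ⟩
  y ⊛ ((qPoch N ⊛ z) ⊛ (qPoch⁻¹ (suc i) ⊛ aj ⊛ ak))
    ≈⟨ solve 6 (λ y z p a b c → y :* ((p :* z) :* (a :* b :* c)) := z :* (p :* ((y :* a) :* b :* c)))
               ≈ₚ-refl y z (qPoch N) (qPoch⁻¹ (suc i)) aj ak ⟩
  z ⊛ (qPoch N ⊛ (qPoch⁻¹-pred (suc i) ⊛ aj ⊛ ak))
    ≈⟨ ⊛-congˡ z (⊛-congˡ (qPoch N) (⊛-congʳ ak (⊛-congʳ aj (qPoch⁻¹-pred-suc i)))) ⟩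
  z ⊛ trinomial i j k ∎
  where
  open ≈ₚ-Reasoning
  open PS-Solver using (solve; _:=_; _:*_)
  N  = i ℕ.+ j ℕ.+ k
  y  = onePS ⊖ X^ (suc i)
  z  = onePS ⊖ X^ (suc N)
  aj = qPoch⁻¹ j
  ak = qPoch⁻¹ k

trinomial-sucⱼ : ∀ i j k → (onePS ⊖ X^ (suc j)) ⊛ trinomial i (suc j) k ≈ₚ (onePS ⊖ X^ (suc (i ℕ.+ j ℕ.+ k))) ⊛ trinomial i j k
trinomial-sucⱼ i j k = begin
  y ⊛ (qPoch (i ℕ.+ suc j ℕ.+ k) ⊛ (ai ⊛ qPoch⁻¹ (suc j) ⊛ ak))
    ≈⟨ ⊛-congˡ y (⊛-congʳ (ai ⊛ qPoch⁻¹ (suc j) ⊛ ak)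
                          (≈ₚ-trans (qPoch-cong (cong (ℕ._+ k) (ℕₚ.+-suc i j))) (⊛-congˡ (qPoch N) (qPoch-factor N)))) ⟩
  y ⊛ ((qPoch N ⊛ z) ⊛ (ai ⊛ qPoch⁻¹ (suc j) ⊛ ak))
    ≈⟨ solve 6 (λ y z p a b c → y :* ((p :* z) :* (a :* b :* c)) := z :* (p :* (a :* (y :* b) :* c)))
               ≈ₚ-refl y z (qPoch N) ai (qPoch⁻¹ (suc j)) ak ⟩
  z ⊛ (qPoch N ⊛ (ai ⊛ qPoch⁻¹-pred (suc j) ⊛ ak))
    ≈⟨ ⊛-congˡ z (⊛-congˡ (qPoch N) (⊛-congʳ ak (⊛-congˡ ai (qPoch⁻¹-pred-suc j)))) ⟩
  z ⊛ trinomial i j k ∎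
  where
  open ≈ₚ-Reasoning
  open PS-Solver using (solve; _:=_; _:*_)
  N  = i ℕ.+ j ℕ.+ k
  y  = onePS ⊖ X^ (suc j)
  z  = onePS ⊖ X^ (suc N)
  ai = qPoch⁻¹ i
  ak = qPoch⁻¹ k

ΣP : ℕ → (ℕ → PS) → PS
ΣP n F N = sumTo n (λ i → F i N)

ΣP-cong : ∀ n {F G : ℕ → PS} → (∀ i → i ≤ n → F i ≈ₚ G i) → ΣP n F ≈ₚ ΣP n G
ΣP-cong n F≈G N = sumTo-cong n (λ i i≤n → F≈G i i≤n N)

ΣP-⊕ : ∀ n (F G : ℕ → PS) → ΣP n (λ i → F i ⊕ G i) ≈ₚ ΣP n F ⊕ ΣP n G
ΣP-⊕ n F G N = sumTo-+ n (λ i → F i N) (λ i → G i N)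

ΣP-⊝ : ∀ n (F : ℕ → PS) → ΣP n (λ i → ⊝ F i) ≈ₚ ⊝ ΣP n F
ΣP-⊝ n F N = sym (sumTo-neg n (λ i → F i N))

ΣP-⊛ : ∀ n h (F : ℕ → PS) → h ⊛ ΣP n F ≈ₚ ΣP n (λ i → h ⊛ F i)
ΣP-⊛ n h F N = trans (sumTo-cong N (λ t _ → sumTo-*ˡ n (h t) (λ i → F i (N ∸ t))))
                     (sumTo-swap N n (λ t i → h t * F i (N ∸ t)))

ΣP-zero : ∀ n (F : ℕ → PS) → (∀ i → i ≤ n → F i ≈ₚ zeroPS) → ΣP n F ≈ₚ zeroPS
ΣP-zero n F F≈0 N = sumTo-zero n (λ i → F i N) (λ i i≤n → F≈0 i i≤n N)

ΣP-dropLast : ∀ n (F : ℕ → PS) → F (suc n) ≈ₚ zeroPS → ΣP (suc n) F ≈ₚ ΣP n F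
ΣP-dropLast n F Fₙ≈0 N = trans (cong (ΣP n F N +_) (Fₙ≈0 N)) (+-identityʳ (ΣP n F N))

ΣP-shift : ∀ n (F : ℕ → PS) → F 0 ≈ₚ zeroPS → F (suc n) ≈ₚ zeroPS → ΣP n F ≈ₚ ΣP n (F ∘ suc)
ΣP-shift n F F₀≈0 Fₙ≈0 N = begin
  ΣP n F N                                  ≡⟨ ΣP-dropLast n F Fₙ≈0 N ⟨
  ΣP (suc n) F N                            ≡⟨ sumTo-suc n (λ i → F i N) ⟩
  F 0 N + ΣP n (F ∘ suc) N                  ≡⟨ cong (_+ ΣP n (F ∘ suc) N) (F₀≈0 N) ⟩
  0ℚ + ΣP n (F ∘ suc) N                     ≡⟨ +-identityˡ _ ⟩
  ΣP n (F ∘ suc) N                          ∎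
  where open ≡-Reasoning

ΣP-extend : ∀ {n} m (F : ℕ → PS) → n ≤ m → (∀ i → n < i → i ≤ m → F i ≈ₚ zeroPS) → ΣP m F ≈ₚ ΣP n F
ΣP-extend m F n≤m F≈0 N = sumTo-extend m (λ i → F i N) n≤m (λ i n<i i≤m → F≈0 i n<i i≤m N)

ΣP-swap : ∀ n m (F : ℕ → ℕ → PS) → ΣP n (λ i → ΣP m (F i)) ≈ₚ ΣP m (λ j → ΣP n (λ i → F i j))
ΣP-swap n m F N = sumTo-swap n m (λ i j → F i j N)

kronecker : ℕ → ℕ → PS → PS
kronecker a M f = if a ≡ᵇ M then f else zeroPS

kronecker-≢ : ∀ {a M} f → a ≢ M → kronecker a M f ≈ₚ zeroPS
kronecker-≢ f a≢M rewrite ≡ᵇ-false a≢M = ≈ₚ-refl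

kronecker-refl : ∀ M f → kronecker M M f ≈ₚ f
kronecker-refl M f rewrite ≡ᵇ-true M = ≈ₚ-refl

kronecker-cong : ∀ {a b M f g} → a ≡ b → (a ≡ M → f ≈ₚ g) → kronecker a M f ≈ₚ kronecker b M g
kronecker-cong {a} {_} {M} {f} {g} refl f≈g with a ℕ.≟ M
... | yes refl = ≈ₚ-trans (kronecker-refl a f) (≈ₚ-trans (f≈g refl) (≈ₚ-sym (kronecker-refl a g)))
... | no a≢M   = ≈ₚ-trans (kronecker-≢ f a≢M) (≈ₚ-sym (kronecker-≢ g a≢M))

kronecker-zero : ∀ a M {f} → f ≈ₚ zeroPS → kronecker a M f ≈ₚ zeroPS
kronecker-zero a M f≈0 with a ≡ᵇ M
... | true  = f≈0
... | false = ≈ₚ-refl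

kronecker-⊕ : ∀ a M f g → kronecker a M (f ⊕ g) ≈ₚ kronecker a M f ⊕ kronecker a M g
kronecker-⊕ a M f g with a ≡ᵇ M
... | true  = ≈ₚ-refl
... | false = λ N → sym (+-identityʳ 0ℚ)

kronecker-⊝ : ∀ a M f → kronecker a M (⊝ f) ≈ₚ ⊝ kronecker a M f
kronecker-⊝ a M f with a ≡ᵇ M
... | true  = ≈ₚ-refl
... | false = λ N → refl

kronecker-⊛ : ∀ a M h f → h ⊛ kronecker a M f ≈ₚ kronecker a M (h ⊛ f)
kronecker-⊛ a M h f with a ≡ᵇ M
... | true  = ≈ₚ-refl
... | false = ⊛-zeroʳ h

ΣP-kronecker-≤ : ∀ a M (f : ℕ → PS) → a ≤ M → ΣP M (λ k → kronecker (a ℕ.+ k) M (f k)) ≈ₚ f (M ∸ a)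
ΣP-kronecker-≤ a M f a≤M N = begin
  ΣP M (λ k → kronecker (a ℕ.+ k) M (f k)) N
    ≡⟨ sumTo-singleton M (M ∸ a) _ (ℕₚ.m∸n≤m M a)
         (λ k _ k≢M∸a → kronecker-≢ (f k) (λ a+k≡M → k≢M∸a (trans (sym (ℕₚ.m+n∸m≡n a k)) (cong (ℕ._∸ a) a+k≡M))) N) ⟩
  kronecker (a ℕ.+ (M ∸ a)) M (f (M ∸ a)) N
    ≡⟨ kronecker-cong (ℕₚ.m+[n∸m]≡n a≤M) (λ _ → ≈ₚ-refl) N ⟩
  kronecker M M (f (M ∸ a)) N
    ≡⟨ kronecker-refl M (f (M ∸ a)) N ⟩
  f (M ∸ a) N ∎
  where open ≡-Reasoning

ΣP-kronecker-> : ∀ a M (f : ℕ → PS) → M < a → ΣP M (λ k → kronecker (a ℕ.+ k) M (f k)) ≈ₚ zeroPS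
ΣP-kronecker-> a M f M<a = ΣP-zero M _ (λ k _ →
  kronecker-≢ (f k) (λ a+k≡M → ℕₚ.<⇒≱ M<a (subst (a ≤_) a+k≡M (ℕₚ.m≤m+n a k))))

Family : Set
Family = ℕ → ℕ → ℕ → PS

level : ℕ → ℕ → ℕ → ℕ
level i j k = 2 ℕ.* i ℕ.+ j ℕ.+ k

-- Φ summed over d + 2i + j + k = M (each index is at most M)
simplexSum : ℕ → ℕ → Family → PS
simplexSum d M Φ = ΣP M (λ i → ΣP M (λ j → ΣP M (λ k → kronecker (d ℕ.+ level i j k) M (Φ i j k))))

level-suc-k : ∀ i j k → level i j (suc k) ≡ suc (level i j k)
level-suc-k i j k = ℕₚ.+-suc (2 ℕ.* i ℕ.+ j) k

level-suc-j : ∀ i j k → level i (suc j) k ≡ suc (level i j k)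
level-suc-j i j k = cong (ℕ._+ k) (ℕₚ.+-suc (2 ℕ.* i) j)

level-suc-i : ∀ i j k → level (suc i) j k ≡ suc (suc (level i j k))
level-suc-i i j k = cong (λ n → suc n ℕ.+ j ℕ.+ k) (ℕₚ.+-suc i (i ℕ.+ 0))

k≤level : ∀ i j k → k ≤ level i j k
k≤level i j k = ℕₚ.m≤n+m k (2 ℕ.* i ℕ.+ j)

j≤level : ∀ i j k → j ≤ level i j k
j≤level i j k = ℕₚ.≤-trans (ℕₚ.m≤n+m j (2 ℕ.* i)) (ℕₚ.m≤m+n (2 ℕ.* i ℕ.+ j) k)

i≤level : ∀ i j k → i ≤ level i j k
i≤level i j k = ℕₚ.≤-trans (ℕₚ.m≤m+n i (i ℕ.+ 0)) (ℕₚ.≤-trans (ℕₚ.m≤m+n (2 ℕ.* i) j) (ℕₚ.m≤m+n (2 ℕ.* i ℕ.+ j) k))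

kronecker-beyond : ∀ d {M n} i j k f → n ≤ level i j k → M < n → kronecker (d ℕ.+ level i j k) M f ≈ₚ zeroPS
kronecker-beyond d {M} i j k f n≤level M<n =
  kronecker-≢ f (λ d+level≡M → ℕₚ.<⇒≱ (ℕₚ.<-≤-trans M<n (ℕₚ.≤-trans n≤level (ℕₚ.m≤n+m (level i j k) d)))
                                        (ℕₚ.≤-reflexive d+level≡M))

simplexSum-cong : ∀ d M {Φ Ψ : Family} → (∀ i j k → d ℕ.+ level i j k ≡ M → Φ i j k ≈ₚ Ψ i j k) →
                  simplexSum d M Φ ≈ₚ simplexSum d M Ψ
simplexSum-cong d M Φ≈Ψ =
  ΣP-cong M (λ i _ → ΣP-cong M (λ j _ → ΣP-cong M (λ k _ → kronecker-cong refl (Φ≈Ψ i j k))))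

simplexSum-⊕ : ∀ d M (Φ Ψ : Family) → simplexSum d M (λ i j k → Φ i j k ⊕ Ψ i j k) ≈ₚ simplexSum d M Φ ⊕ simplexSum d M Ψ
simplexSum-⊕ d M Φ Ψ =
  ≈ₚ-trans (ΣP-cong M (λ i _ →
    ≈ₚ-trans (ΣP-cong M (λ j _ →
      ≈ₚ-trans (ΣP-cong M (λ k _ → kronecker-⊕ (d ℕ.+ level i j k) M (Φ i j k) (Ψ i j k))) (ΣP-⊕ M _ _)))
      (ΣP-⊕ M _ _)))
    (ΣP-⊕ M _ _)

simplexSum-⊝ : ∀ d M (Φ : Family) → simplexSum d M (λ i j k → ⊝ Φ i j k) ≈ₚ ⊝ simplexSum d M Φ
simplexSum-⊝ d M Φ =
  ≈ₚ-trans (ΣP-cong M (λ i _ →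
    ≈ₚ-trans (ΣP-cong M (λ j _ →
      ≈ₚ-trans (ΣP-cong M (λ k _ → kronecker-⊝ (d ℕ.+ level i j k) M (Φ i j k))) (ΣP-⊝ M _)))
      (ΣP-⊝ M _)))
    (ΣP-⊝ M _)

simplexSum-⊛ : ∀ d M h (Φ : Family) → h ⊛ simplexSum d M Φ ≈ₚ simplexSum d M (λ i j k → h ⊛ Φ i j k)
simplexSum-⊛ d M h Φ =
  ≈ₚ-trans (ΣP-⊛ M h row) (ΣP-cong M (λ i _ →
    ≈ₚ-trans (ΣP-⊛ M h (column i)) (ΣP-cong M (λ j _ →
      ≈ₚ-trans (ΣP-⊛ M h (entry i j)) (ΣP-cong M (λ k _ → kronecker-⊛ (d ℕ.+ level i j k) M h (Φ i j k)))))))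
  where
  entry : ℕ → ℕ → ℕ → PS
  entry i j k = kronecker (d ℕ.+ level i j k) M (Φ i j k)
  column : ℕ → ℕ → PS
  column i j = ΣP M (entry i j)
  row : ℕ → PS
  row i = ΣP M (column i)

simplexSum-shiftₖ : ∀ d M (V W : Family) → (∀ i j → V i j 0 ≈ₚ zeroPS) → (∀ i j k → V i j (suc k) ≈ₚ W i j k) →
                    simplexSum d M V ≈ₚ simplexSum (suc d) M W
simplexSum-shiftₖ d M V W V₀≈0 V≈W = ΣP-cong M (λ i _ → ΣP-cong M (λ j _ →
  ≈ₚ-trans (ΣP-shift M _ (kronecker-zero (d ℕ.+ level i j 0) M (V₀≈0 i j))
                         (kronecker-beyond d i j (suc M) (V i j (suc M)) (k≤level i j (suc M)) ℕₚ.≤-refl))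
           (ΣP-cong M (λ k _ → kronecker-cong (trans (cong (d ℕ.+_) (level-suc-k i j k)) (ℕₚ.+-suc d (level i j k)))
                                              (λ _ → V≈W i j k)))))

simplexSum-shiftⱼ : ∀ d M (V W : Family) → (∀ i k → V i 0 k ≈ₚ zeroPS) → (∀ i j k → V i (suc j) k ≈ₚ W i j k) →
                    simplexSum d M V ≈ₚ simplexSum (suc d) M W
simplexSum-shiftⱼ d M V W V₀≈0 V≈W = ΣP-cong M (λ i _ →
  ≈ₚ-trans (ΣP-shift M _ (ΣP-zero M _ (λ k _ → kronecker-zero (d ℕ.+ level i 0 k) M (V₀≈0 i k)))
                         (ΣP-zero M _ (λ k _ → kronecker-beyond d i (suc M) k (V i (suc M) k) (j≤level i (suc M) k) ℕₚ.≤-refl)))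
           (ΣP-cong M (λ j _ → ΣP-cong M (λ k _ →
              kronecker-cong (trans (cong (d ℕ.+_) (level-suc-j i j k)) (ℕₚ.+-suc d (level i j k))) (λ _ → V≈W i j k)))))

simplexSum-shiftᵢ : ∀ d M (V W : Family) → (∀ j k → V 0 j k ≈ₚ zeroPS) → (∀ i j k → V (suc i) j k ≈ₚ W i j k) →
                    simplexSum d M V ≈ₚ simplexSum (suc (suc d)) M W
simplexSum-shiftᵢ d M V W V₀≈0 V≈W =
  ≈ₚ-trans (ΣP-shift M _ (ΣP-zero M _ (λ j _ → ΣP-zero M _ (λ k _ → kronecker-zero (d ℕ.+ level 0 j k) M (V₀≈0 j k))))
                         (ΣP-zero M _ (λ j _ → ΣP-zero M _ (λ k _ →
                            kronecker-beyond d (suc M) j k (V (suc M) j k) (i≤level (suc M) j k) ℕₚ.≤-refl))))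
           (ΣP-cong M (λ i _ → ΣP-cong M (λ j _ → ΣP-cong M (λ k _ →
              kronecker-cong (trans (cong (d ℕ.+_) (level-suc-i i j k))
                                    (trans (ℕₚ.+-suc d (suc (level i j k))) (cong suc (ℕₚ.+-suc d (level i j k)))))
                             (λ _ → V≈W i j k)))))

simplexSum-pred : ∀ d M (Φ : Family) → simplexSum (suc d) (suc M) Φ ≈ₚ simplexSum d M Φ
simplexSum-pred d M Φ =
  ≈ₚ-trans (ΣP-dropLast M _ (ΣP-zero (suc M) _ (λ j _ → ΣP-zero (suc M) _ (λ k _ → beyond (i≤level (suc M) j k)))))
  (ΣP-cong M (λ i _ →
    ≈ₚ-trans (ΣP-dropLast M _ (ΣP-zero (suc M) _ (λ k _ → beyond (j≤level i (suc M) k))))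
    (ΣP-cong M (λ j _ → ΣP-dropLast M _ (beyond (k≤level i j (suc M)))))))
  where
  beyond : ∀ {i j k} → suc M ≤ level i j k → kronecker (d ℕ.+ level i j k) M (Φ i j k) ≈ₚ zeroPS
  beyond {i} {j} {k} M<level = kronecker-beyond d i j k (Φ i j k) M<level ℕₚ.≤-refl

module TrinomialSum (w : ℕ → ℕ → ℕ) (δ : ℕ)
  (w-sucⱼ : ∀ i j → w i (suc j) ≡ δ ℕ.+ i ℕ.+ j ℕ.+ w i j)
  (w-sucᵢ : ∀ i j → w (suc i) j ≡ δ ℕ.+ 2 ℕ.* i ℕ.+ j ℕ.+ 1 ℕ.+ w i j) where

  term : Family
  term i j k = X^ (w i j) ⊛ trinomial i j k

  trinomialSum : ℕ → ℕ → PS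
  trinomialSum d M = simplexSum d M term

  termₖ⁻ termⱼ⁻ termᵢ⁻ termⱼ termᵢ Ψ : Family
  termₖ⁻ i j k = X^ (w i j) ⊛ trinomialₖ⁻ i j k
  termⱼ⁻ i j k = X^ (w i j) ⊛ (X^ k ⊛ trinomialⱼ⁻ i j k)
  termᵢ⁻ i j k = X^ (w i j) ⊛ (X^ (j ℕ.+ k) ⊛ trinomialᵢ⁻ i j k)
  termⱼ  i j k = X^ (w i (suc j)) ⊛ (X^ k ⊛ trinomial i j k)
  termᵢ  i j k = X^ (w (suc i) j) ⊛ (X^ (j ℕ.+ k) ⊛ trinomial i j k)
  Ψ      i j k = X^ (w (suc i) (suc j) ℕ.+ k) ⊛ ((onePS ⊖ X^ (suc (i ℕ.+ j ℕ.+ k))) ⊛ trinomial i j k)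

  arith₁ : ∀ i j k M → level i j k ≡ M → M ℕ.+ δ ℕ.+ w i j ≡ (w i (suc j) ℕ.+ k) ℕ.+ i
  arith₁ i j k M refl rewrite w-sucⱼ i j = lemma i j k δ (w i j)
    where
    lemma : ∀ i j k d x → 2 ℕ.* i ℕ.+ j ℕ.+ k ℕ.+ d ℕ.+ x ≡ (d ℕ.+ i ℕ.+ j ℕ.+ x ℕ.+ k) ℕ.+ i
    lemma = solve-∀

  arith₂ : ∀ i j k M → suc (level i j k) ≡ M → w (suc i) j ℕ.+ (j ℕ.+ k) ≡ (M ℕ.+ δ ℕ.+ w i j) ℕ.+ j
  arith₂ i j k M refl rewrite w-sucᵢ i j = lemma i j k δ (w i j)
    where
    lemma : ∀ i j k d x → d ℕ.+ 2 ℕ.* i ℕ.+ j ℕ.+ 1 ℕ.+ x ℕ.+ (j ℕ.+ k) ≡ (suc (2 ℕ.* i ℕ.+ j ℕ.+ k) ℕ.+ d ℕ.+ x) ℕ.+ j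
    lemma = solve-∀

  arith₃ : ∀ i j k M → suc (suc (level i j k)) ≡ M → M ℕ.+ δ ℕ.+ w i (suc j) ≡ w (suc i) (suc j) ℕ.+ k
  arith₃ i j k M refl rewrite w-sucᵢ i (suc j) = lemma i j k δ (w i (suc j))
    where
    lemma : ∀ i j k d x → suc (suc (2 ℕ.* i ℕ.+ j ℕ.+ k)) ℕ.+ d ℕ.+ x ≡ d ℕ.+ 2 ℕ.* i ℕ.+ suc j ℕ.+ 1 ℕ.+ x ℕ.+ k
    lemma = solve-∀

  positive-size : ∀ i j k M → level i j k ≡ suc M → i ℕ.+ j ℕ.+ k ≡ suc (i ℕ.+ j ℕ.+ k ∸ 1)
  positive-size (suc i) j       k       M _  = refl
  positive-size zero    (suc j) k       M _  = refl
  positive-size zero    zero    (suc k) M _  = refl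
  positive-size zero    zero    zero    M ()

  trinomialSum-pascal : ∀ M → trinomialSum 0 (suc M) ≈ₚ trinomialSum 0 M ⊕ simplexSum 0 M termⱼ ⊕ simplexSum 1 M termᵢ
  trinomialSum-pascal M = begin
    trinomialSum 0 (suc M)
      ≈⟨ simplexSum-cong 0 (suc M) (λ i j k level≡ →
           ≈ₚ-trans (⊛-congˡ (X^ (w i j)) (trinomial-pascal i j k _ (positive-size i j k M level≡)))
                    (solve 4 (λ x a b c → x :* (a :+ b :+ c) := x :* a :+ x :* b :+ x :* c) ≈ₚ-refl
                             (X^ (w i j)) (trinomialₖ⁻ i j k) (X^ k ⊛ trinomialⱼ⁻ i j k) (X^ (j ℕ.+ k) ⊛ trinomialᵢ⁻ i j k))) ⟩
    simplexSum 0 (suc M) (λ i j k → termₖ⁻ i j k ⊕ termⱼ⁻ i j k ⊕ termᵢ⁻ i j k)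
      ≈⟨ ≈ₚ-trans (simplexSum-⊕ 0 (suc M) _ termᵢ⁻) (⊕-cong (simplexSum-⊕ 0 (suc M) termₖ⁻ termⱼ⁻) ≈ₚ-refl) ⟩
    simplexSum 0 (suc M) termₖ⁻ ⊕ simplexSum 0 (suc M) termⱼ⁻ ⊕ simplexSum 0 (suc M) termᵢ⁻
      ≈⟨ ⊕-cong (⊕-cong
           (simplexSum-shiftₖ 0 (suc M) termₖ⁻ term
              (λ i j → ⊛-absorbʳ (X^ (w i j)) (trinomialₖ⁻-zero i j))
              (λ i j k → ⊛-congˡ (X^ (w i j)) (trinomialₖ⁻-suc i j k)))
           (simplexSum-shiftⱼ 0 (suc M) termⱼ⁻ termⱼ
              (λ i k → ⊛-absorbʳ (X^ (w i 0)) (⊛-absorbʳ (X^ k) (trinomialⱼ⁻-zero i k)))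
              (λ i j k → ⊛-congˡ (X^ (w i (suc j))) (⊛-congˡ (X^ k) (trinomialⱼ⁻-suc i j k)))))
           (simplexSum-shiftᵢ 0 (suc M) termᵢ⁻ termᵢ
              (λ j k → ⊛-absorbʳ (X^ (w 0 j)) (⊛-absorbʳ (X^ (j ℕ.+ k)) (trinomialᵢ⁻-zero j k)))
              (λ i j k → ⊛-congˡ (X^ (w (suc i) j)) (⊛-congˡ (X^ (j ℕ.+ k)) (trinomialᵢ⁻-suc i j k)))) ⟩
    simplexSum 1 (suc M) term ⊕ simplexSum 1 (suc M) termⱼ ⊕ simplexSum 2 (suc M) termᵢ
      ≈⟨ ⊕-cong (⊕-cong (simplexSum-pred 0 M term) (simplexSum-pred 0 M termⱼ)) (simplexSum-pred 1 M termᵢ) ⟩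
    trinomialSum 0 M ⊕ simplexSum 0 M termⱼ ⊕ simplexSum 1 M termᵢ ∎
    where
    open ≈ₚ-Reasoning
    open PS-Solver using (solve; _:=_; _:+_; _:*_)

  -- The conditions on w make the j- and i-pieces of the q-Pascal split exceed q^{M+δ} times the sums at
  -- levels M and M - 1 by the same simplex sum of Ψ, with opposite signs.
  termⱼ-excess : ∀ M → simplexSum 0 M termⱼ ⊖ X^ (M ℕ.+ δ) ⊛ trinomialSum 0 M ≈ₚ simplexSum 2 M Ψ
  termⱼ-excess M = begin
    simplexSum 0 M termⱼ ⊖ X^ (M ℕ.+ δ) ⊛ trinomialSum 0 M
      ≈⟨ ⊖-cong (≈ₚ-refl {simplexSum 0 M termⱼ}) (simplexSum-⊛ 0 M (X^ (M ℕ.+ δ)) term) ⟩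
    simplexSum 0 M termⱼ ⊖ simplexSum 0 M (λ i j k → X^ (M ℕ.+ δ) ⊛ term i j k)
      ≈⟨ ≈ₚ-trans (⊕-cong (≈ₚ-refl {simplexSum 0 M termⱼ}) (≈ₚ-sym (simplexSum-⊝ 0 M _))) (≈ₚ-sym (simplexSum-⊕ 0 M termⱼ _)) ⟩
    simplexSum 0 M (λ i j k → termⱼ i j k ⊖ X^ (M ℕ.+ δ) ⊛ term i j k)
      ≈⟨ simplexSum-cong 0 M (λ i j k level≡M →
           ≈ₚ-trans (⊖-cong (X^-⊛-X^-⊛ (w i (suc j)) k (trinomial i j k))
                            (≈ₚ-trans (X^-⊛-X^-⊛ (M ℕ.+ δ) (w i j) (trinomial i j k))
                                      (⊛-congʳ (trinomial i j k) (≈ₚ-trans (X^-cong (arith₁ i j k M level≡M))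
                                                                           (≈ₚ-sym (X^-⊛-X^ (w i (suc j) ℕ.+ k) i))))))
                    (solve 3 (λ x y t → x :* t :- (x :* y) :* t := x :* ((con 1ℚ :- y) :* t)) ≈ₚ-refl
                             (X^ (w i (suc j) ℕ.+ k)) (X^ i) (trinomial i j k))) ⟩
    simplexSum 0 M (λ i j k → X^ (w i (suc j) ℕ.+ k) ⊛ ((onePS ⊖ X^ i) ⊛ trinomial i j k))
      ≈⟨ simplexSum-shiftᵢ 0 M _ Ψ
           (λ j k → ⊛-absorbʳ (X^ (w 0 (suc j) ℕ.+ k)) (⊛-absorbˡ (trinomial 0 j k) one⊖X^0≈0))
           (λ i j k → ⊛-congˡ (X^ (w (suc i) (suc j) ℕ.+ k)) (trinomial-sucᵢ i j k)) ⟩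
    simplexSum 2 M Ψ ∎
    where
    open ≈ₚ-Reasoning
    open PS-Solver using (solve; _:=_; _:-_; _:*_; con)

  termᵢ-excess : ∀ M → simplexSum 1 M termᵢ ⊖ X^ (M ℕ.+ δ) ⊛ trinomialSum 1 M ≈ₚ ⊝ simplexSum 2 M Ψ
  termᵢ-excess M = begin
    simplexSum 1 M termᵢ ⊖ X^ (M ℕ.+ δ) ⊛ trinomialSum 1 M
      ≈⟨ ⊖-cong (≈ₚ-refl {simplexSum 1 M termᵢ}) (simplexSum-⊛ 1 M (X^ (M ℕ.+ δ)) term) ⟩
    simplexSum 1 M termᵢ ⊖ simplexSum 1 M (λ i j k → X^ (M ℕ.+ δ) ⊛ term i j k)
      ≈⟨ ≈ₚ-trans (⊕-cong (≈ₚ-refl {simplexSum 1 M termᵢ}) (≈ₚ-sym (simplexSum-⊝ 1 M _))) (≈ₚ-sym (simplexSum-⊕ 1 M termᵢ _)) ⟩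
    simplexSum 1 M (λ i j k → termᵢ i j k ⊖ X^ (M ℕ.+ δ) ⊛ term i j k)
      ≈⟨ simplexSum-cong 1 M (λ i j k 1+level≡M →
           ≈ₚ-trans (⊖-cong (≈ₚ-trans (X^-⊛-X^-⊛ (w (suc i) j) (j ℕ.+ k) (trinomial i j k))
                                      (⊛-congʳ (trinomial i j k) (≈ₚ-trans (X^-cong (arith₂ i j k M 1+level≡M))
                                                                           (≈ₚ-sym (X^-⊛-X^ (M ℕ.+ δ ℕ.+ w i j) j)))))
                            (X^-⊛-X^-⊛ (M ℕ.+ δ) (w i j) (trinomial i j k)))
                    (solve 3 (λ x y t → (x :* y) :* t :- x :* t := :- (x :* ((con 1ℚ :- y) :* t))) ≈ₚ-refl
                             (X^ (M ℕ.+ δ ℕ.+ w i j)) (X^ j) (trinomial i j k))) ⟩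
    simplexSum 1 M (λ i j k → ⊝ (X^ (M ℕ.+ δ ℕ.+ w i j) ⊛ ((onePS ⊖ X^ j) ⊛ trinomial i j k)))
      ≈⟨ simplexSum-shiftⱼ 1 M _ (λ i j k → ⊝ (X^ (M ℕ.+ δ ℕ.+ w i (suc j)) ⊛ ((onePS ⊖ X^ (suc (i ℕ.+ j ℕ.+ k))) ⊛ trinomial i j k)))
           (λ i k → ⊝-cong (⊛-absorbʳ (X^ (M ℕ.+ δ ℕ.+ w i 0)) (⊛-absorbˡ (trinomial i 0 k) one⊖X^0≈0)))
           (λ i j k → ⊝-cong (⊛-congˡ (X^ (M ℕ.+ δ ℕ.+ w i (suc j))) (trinomial-sucⱼ i j k))) ⟩
    simplexSum 2 M (λ i j k → ⊝ (X^ (M ℕ.+ δ ℕ.+ w i (suc j)) ⊛ ((onePS ⊖ X^ (suc (i ℕ.+ j ℕ.+ k))) ⊛ trinomial i j k)))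
      ≈⟨ simplexSum-cong 2 M (λ i j k 2+level≡M →
           ⊝-cong (⊛-congʳ ((onePS ⊖ X^ (suc (i ℕ.+ j ℕ.+ k))) ⊛ trinomial i j k) (X^-cong (arith₃ i j k M 2+level≡M)))) ⟩
    simplexSum 2 M (λ i j k → ⊝ Ψ i j k)
      ≈⟨ simplexSum-⊝ 2 M Ψ ⟩
    ⊝ simplexSum 2 M Ψ ∎
    where
    open ≈ₚ-Reasoning
    open PS-Solver using (solve; _:=_; _:-_; _:*_; :-_; con)

  trinomialSum-rec : ∀ M → trinomialSum 0 (suc M) ≈ₚ trinomialSum 0 M ⊕ X^ (M ℕ.+ δ) ⊛ trinomialSum 0 M
                                                     ⊕ X^ (M ℕ.+ δ) ⊛ trinomialSum 1 M
  trinomialSum-rec M = begin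
    trinomialSum 0 (suc M)
      ≈⟨ trinomialSum-pascal M ⟩
    F ⊕ Sⱼ ⊕ Sᵢ
      ≈⟨ solve 5 (λ f a b x g → f :+ a :+ b := f :+ x :* f :+ x :* g :+ ((a :- x :* f) :+ (b :- x :* g))) ≈ₚ-refl F Sⱼ Sᵢ x G ⟩
    F ⊕ x ⊛ F ⊕ x ⊛ G ⊕ ((Sⱼ ⊖ x ⊛ F) ⊕ (Sᵢ ⊖ x ⊛ G))
      ≈⟨ ⊕-cong (≈ₚ-refl {F ⊕ x ⊛ F ⊕ x ⊛ G}) (⊕-cong (termⱼ-excess M) (termᵢ-excess M)) ⟩
    F ⊕ x ⊛ F ⊕ x ⊛ G ⊕ (simplexSum 2 M Ψ ⊖ simplexSum 2 M Ψ)
      ≈⟨ solve 4 (λ f x g s → f :+ x :* f :+ x :* g :+ (s :- s) := f :+ x :* f :+ x :* g) ≈ₚ-refl F x G (simplexSum 2 M Ψ) ⟩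
    F ⊕ x ⊛ F ⊕ x ⊛ G ∎
    where
    open ≈ₚ-Reasoning
    open PS-Solver using (solve; _:=_; _:+_; _:-_; _:*_)
    F  = trinomialSum 0 M
    G  = trinomialSum 1 M
    Sⱼ = simplexSum 0 M termⱼ
    Sᵢ = simplexSum 1 M termᵢ
    x  = X^ (M ℕ.+ δ)

-- With i = l, j = n - l and k = M - l - n, the double sums defining aₘ and bₘ become simplex sums of trinomials

ℤ-difference : ∀ {M l} → l ≤ M → ℤ.+ M ℤ.- ℤ.+ l ≡ ℤ.+ (M ∸ l)
ℤ-difference {M} {l} l≤M = trans (ℤₚ.m-n≡m⊖n M l) (ℤₚ.⊖-≥ l≤M)

gauss-negative : ∀ {M l} n → M < l → gauss (ℤ.+ M ℤ.- ℤ.+ l) n ≈ₚ zeroPS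
gauss-negative {M} {suc l} n (s≤s M≤l)
  rewrite ℤₚ.m-n≡m⊖n M (suc l) | ℤₚ.⊖-< (s≤s M≤l) | ℕₚ.+-∸-assoc 1 M≤l = ≈ₚ-refl

∸-split : ∀ {M} i j → 2 ℕ.* i ℕ.+ j ≤ M → M ∸ i ≡ i ℕ.+ j ℕ.+ (M ∸ (2 ℕ.* i ℕ.+ j))
∸-split {M} i j 2i+j≤M =
  trans (cong (_∸ i) (trans (sym (ℕₚ.m+[n∸m]≡n 2i+j≤M)) (arith i j (M ∸ (2 ℕ.* i ℕ.+ j)))))
        (ℕₚ.m+n∸m≡n i (i ℕ.+ j ℕ.+ (M ∸ (2 ℕ.* i ℕ.+ j))))
  where
  arith : ∀ i j k → 2 ℕ.* i ℕ.+ j ℕ.+ k ≡ i ℕ.+ (i ℕ.+ j ℕ.+ k)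
  arith = solve-∀

module GaussDoubleSum (ω : ℕ → ℕ → ℕ) where

  gaussTerm : ℕ → ℕ → ℕ → PS
  gaussTerm M n l = X^ (ω n l) ⊛ gauss (ℤ.+ M ℤ.- ℤ.+ l) n ⊛ gauss (ℤ.+ n) l

  term : Family
  term i j k = X^ (ω (i ℕ.+ j) i) ⊛ trinomial i j k

  gaussTerm-l>M : ∀ M n l → M < l → gaussTerm M n l ≈ₚ zeroPS
  gaussTerm-l>M M n l M<l = ⊛-absorbˡ (gauss (ℤ.+ n) l) (⊛-absorbʳ (X^ (ω n l)) (gauss-negative n M<l))

  gaussTerm-n>M : ∀ M n l → M < n → gaussTerm M n l ≈ₚ zeroPS
  gaussTerm-n>M M n l M<n with l ℕ.≤? M
  ... | no  l≰M = gaussTerm-l>M M n l (ℕₚ.≰⇒> l≰M)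
  ... | yes l≤M rewrite ℤ-difference l≤M =
    ⊛-absorbˡ (gauss (ℤ.+ n) l) (⊛-absorbʳ (X^ (ω n l)) (gauss-> (ℕₚ.≤-<-trans (ℕₚ.m∸n≤m M l) M<n)))

  gaussTerm-n<l : ∀ M n l → n < l → gaussTerm M n l ≈ₚ zeroPS
  gaussTerm-n<l M n l n<l = ⊛-absorbʳ (X^ (ω n l) ⊛ gauss (ℤ.+ M ℤ.- ℤ.+ l) n) (gauss-> n<l)

  gaussTerm≈column : ∀ M i j → gaussTerm M (i ℕ.+ j) i ≈ₚ ΣP M (λ k → kronecker (level i j k) M (term i j k))
  gaussTerm≈column M i j with 2 ℕ.* i ℕ.+ j ℕ.≤? M
  ... | yes 2i+j≤M
    rewrite ℤ-difference (ℕₚ.≤-trans (i≤level i j 0) (subst (ℕ._≤ M) (sym (ℕₚ.+-identityʳ _)) 2i+j≤M))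
          | ∸-split i j 2i+j≤M = begin
    X^ (ω (i ℕ.+ j) i) ⊛ gauss (ℤ.+ (i ℕ.+ j ℕ.+ k)) (i ℕ.+ j) ⊛ gauss (ℤ.+ (i ℕ.+ j)) i
      ≈⟨ ⊛-assoc (X^ (ω (i ℕ.+ j) i)) (gauss (ℤ.+ (i ℕ.+ j ℕ.+ k)) (i ℕ.+ j)) (gauss (ℤ.+ (i ℕ.+ j)) i) ⟩
    X^ (ω (i ℕ.+ j) i) ⊛ (gauss (ℤ.+ (i ℕ.+ j ℕ.+ k)) (i ℕ.+ j) ⊛ gauss (ℤ.+ (i ℕ.+ j)) i)
      ≈⟨ ⊛-congˡ (X^ (ω (i ℕ.+ j) i)) (gauss-⊛-gauss i j k) ⟩
    term i j k
      ≈⟨ ΣP-kronecker-≤ (2 ℕ.* i ℕ.+ j) M (term i j) 2i+j≤M ⟨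
    ΣP M (λ k → kronecker (level i j k) M (term i j k)) ∎
    where
    open ≈ₚ-Reasoning
    k = M ∸ (2 ℕ.* i ℕ.+ j)
  ... | no 2i+j≰M = ≈ₚ-trans vanishes (≈ₚ-sym (ΣP-kronecker-> (2 ℕ.* i ℕ.+ j) M (term i j) (ℕₚ.≰⇒> 2i+j≰M)))
    where
    vanishes : gaussTerm M (i ℕ.+ j) i ≈ₚ zeroPS
    vanishes with i ℕ.≤? M
    ... | no  i≰M = gaussTerm-l>M M (i ℕ.+ j) i (ℕₚ.≰⇒> i≰M)
    ... | yes i≤M rewrite ℤ-difference i≤M =
      ⊛-absorbˡ (gauss (ℤ.+ (i ℕ.+ j)) i) (⊛-absorbʳ (X^ (ω (i ℕ.+ j) i)) (gauss-> M∸i<i+j))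
      where
      arith : ∀ i j → 2 ℕ.* i ℕ.+ j ≡ i ℕ.+ (i ℕ.+ j)
      arith = solve-∀
      M∸i<i+j : M ∸ i < i ℕ.+ j
      M∸i<i+j = ℕₚ.+-cancelˡ-< i (M ∸ i) (i ℕ.+ j)
                  (subst₂ ℕ._<_ (sym (ℕₚ.m+[n∸m]≡n i≤M)) (arith i j) (ℕₚ.≰⇒> 2i+j≰M))

  gaussTerm-reindex : ∀ M i → i ≤ M → ΣP M (λ n → gaussTerm M n i) ≈ₚ ΣP M (λ j → gaussTerm M (i ℕ.+ j) i)
  gaussTerm-reindex M i i≤M =
    ≈ₚ-trans (λ N → sumTo-dropPrefix i M (λ n → gaussTerm M n i N) (λ n n<i → gaussTerm-n<l M n i n<i N) i≤M)
             (≈ₚ-sym (ΣP-extend M _ (ℕₚ.m∸n≤m M i) (λ j M∸i<j _ →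
                gaussTerm-n>M M (i ℕ.+ j) i (subst (ℕ._< i ℕ.+ j) (ℕₚ.m+[n∸m]≡n i≤M) (ℕₚ.+-monoʳ-< i M∸i<j)))))

  gaussDoubleSum≈simplexSum : ∀ M B → M ≤ B → ΣP B (λ n → ΣP B (λ l → gaussTerm M n l)) ≈ₚ simplexSum 0 M term
  gaussDoubleSum≈simplexSum M B M≤B = begin
    ΣP B (λ n → ΣP B (λ l → gaussTerm M n l))
      ≈⟨ ΣP-cong B (λ n _ → ΣP-extend B _ M≤B (λ l M<l _ → gaussTerm-l>M M n l M<l)) ⟩
    ΣP B (λ n → ΣP M (λ l → gaussTerm M n l))
      ≈⟨ ΣP-extend B _ M≤B (λ n M<n _ → ΣP-zero M _ (λ l _ → gaussTerm-n>M M n l M<n)) ⟩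
    ΣP M (λ n → ΣP M (λ l → gaussTerm M n l))
      ≈⟨ ΣP-swap M M (λ n l → gaussTerm M n l) ⟩
    ΣP M (λ i → ΣP M (λ n → gaussTerm M n i))
      ≈⟨ ΣP-cong M (λ i i≤M → ≈ₚ-trans (gaussTerm-reindex M i i≤M) (ΣP-cong M (λ j _ → gaussTerm≈column M i j))) ⟩
    simplexSum 0 M term ∎
    where open ≈ₚ-Reasoning

-- Second-order linear recurrences

record LinearRecurrence (α β c : ℕ → PS) : Set where
  field
    step : ∀ m → c (suc (suc m)) ≈ₚ α m ⊛ c m ⊕ β m ⊛ c (suc m)

open LinearRecurrence

LinearRecurrence-cong : ∀ {α β c d} → (∀ m → c m ≈ₚ d m) → LinearRecurrence α β c → LinearRecurrence α β d
LinearRecurrence-cong {α} {β} c≈d rec .step m =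
  ≈ₚ-trans (≈ₚ-sym (c≈d (suc (suc m)))) (≈ₚ-trans (rec .step m) (⊕-cong (⊛-congˡ (α m) (c≈d m)) (⊛-congˡ (β m) (c≈d (suc m)))))

LinearRecurrence-combine : ∀ {α β c d} → LinearRecurrence α β c → LinearRecurrence α β d →
                           ∀ x y → LinearRecurrence α β (λ m → c m ⊛ x ⊕ d m ⊛ y)
LinearRecurrence-combine {α} {β} {c} {d} c-rec d-rec x y .step m = begin
  c (suc (suc m)) ⊛ x ⊕ d (suc (suc m)) ⊛ y
    ≈⟨ ⊕-cong (⊛-congʳ x (c-rec .step m)) (⊛-congʳ y (d-rec .step m)) ⟩
  (α m ⊛ c m ⊕ β m ⊛ c (suc m)) ⊛ x ⊕ (α m ⊛ d m ⊕ β m ⊛ d (suc m)) ⊛ y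
    ≈⟨ solve 8 (λ a b c₀ c₁ d₀ d₁ x y → (a :* c₀ :+ b :* c₁) :* x :+ (a :* d₀ :+ b :* d₁) :* y
                                        := a :* (c₀ :* x :+ d₀ :* y) :+ b :* (c₁ :* x :+ d₁ :* y))
               ≈ₚ-refl (α m) (β m) (c m) (c (suc m)) (d m) (d (suc m)) x y ⟩
  α m ⊛ (c m ⊛ x ⊕ d m ⊛ y) ⊕ β m ⊛ (c (suc m) ⊛ x ⊕ d (suc m) ⊛ y) ∎
  where
  open ≈ₚ-Reasoning
  open PS-Solver using (solve; _:=_; _:+_; _:*_)

LinearRecurrence-alternate : ∀ {α β c} → LinearRecurrence α β c →
                             LinearRecurrence α (λ m → ⊝ β m) (λ m → (- sgn m) · c m)
LinearRecurrence-alternate {α} {β} {c} rec .step m = begin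
  (- sgn (suc (suc m))) · c (suc (suc m))
    ≈⟨ ·-as-⊛ (- sgn (suc (suc m))) (c (suc (suc m))) ⟩
  cst (- - s) ⊛ c (suc (suc m))
    ≈⟨ ⊛-cong (≈ₚ-trans (cst-neg (- s)) (⊝-cong (cst-neg s))) (rec .step m) ⟩
  (⊝ ⊝ cst s) ⊛ (α m ⊛ c m ⊕ β m ⊛ c (suc m))
    ≈⟨ solve 5 (λ s a b c₀ c₁ → (:- (:- s)) :* (a :* c₀ :+ b :* c₁) := a :* (s :* c₀) :+ (:- b) :* ((:- s) :* c₁))
               ≈ₚ-refl (cst s) (α m) (β m) (c m) (c (suc m)) ⟩
  α m ⊛ (cst s ⊛ c m) ⊕ (⊝ β m) ⊛ ((⊝ cst s) ⊛ c (suc m))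
    ≈⟨ ⊕-cong (⊛-congˡ (α m) (cst-⊛ s (c m)))
              (⊛-congˡ (⊝ β m) (≈ₚ-trans (⊛-congʳ (c (suc m)) (≈ₚ-sym (cst-neg s))) (cst-⊛ (- s) (c (suc m))))) ⟩
  α m ⊛ (s · c m) ⊕ (⊝ β m) ⊛ ((- s) · c (suc m)) ∎
  where
  open ≈ₚ-Reasoning
  open PS-Solver using (solve; _:=_; _:+_; _:*_; :-_)
  s = - sgn m

LinearRecurrence-unique : ∀ {α β c d} → LinearRecurrence α β c → LinearRecurrence α β d →
                          c 0 ≈ₚ d 0 → c 1 ≈ₚ d 1 → ∀ m → c m ≈ₚ d m
LinearRecurrence-unique {α} {β} {c} {d} c-rec d-rec c₀≈d₀ c₁≈d₁ m = proj₁ (agree m)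
  where
  agree : ∀ m → c m ≈ₚ d m × c (suc m) ≈ₚ d (suc m)
  agree zero    = c₀≈d₀ , c₁≈d₁
  agree (suc m) with agree m
  ... | cₘ≈dₘ , cₘ₊₁≈dₘ₊₁ =
    cₘ₊₁≈dₘ₊₁ , ≈ₚ-trans (c-rec .step m) (≈ₚ-trans (⊕-cong (⊛-congˡ (α m) cₘ≈dₘ) (⊛-congˡ (β m) cₘ₊₁≈dₘ₊₁)) (≈ₚ-sym (d-rec .step m)))

tri₋-suc : ∀ m → tri₋ (suc m) ≡ tri₋ m ℕ.+ m
tri₋-suc zero    = refl
tri₋-suc (suc k) = begin
  (suc (suc k) ℕ.* suc k) ℕ./ 2            ≡⟨ cong (ℕ._/ 2) (arith k) ⟩
  (suc k ℕ.* k ℕ.+ suc k ℕ.* 2) ℕ./ 2      ≡⟨ +-distrib-/-∣ʳ (suc k ℕ.* k) (n∣m*n (suc k)) ⟩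
  tri₋ (suc k) ℕ.+ (suc k ℕ.* 2) ℕ./ 2     ≡⟨ cong (tri₋ (suc k) ℕ.+_) (m*n/n≡m (suc k) 2) ⟩
  tri₋ (suc k) ℕ.+ suc k                   ∎
  where
  open ≡-Reasoning
  arith : ∀ k → suc (suc k) ℕ.* suc k ≡ suc k ℕ.* k ℕ.+ suc k ℕ.* 2
  arith = solve-∀

tri₊≡tri₋+n : ∀ n → tri₊ n ≡ tri₋ n ℕ.+ n
tri₊≡tri₋+n n = trans (cong (ℕ._/ 2) (ℕₚ.*-comm n (suc n))) (tri₋-suc n)

tri₊-suc : ∀ n → tri₊ (suc n) ≡ tri₊ n ℕ.+ suc n
tri₊-suc n = begin
  tri₊ (suc n)                   ≡⟨ tri₊≡tri₋+n (suc n) ⟩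
  tri₋ (suc n) ℕ.+ suc n         ≡⟨ cong (ℕ._+ suc n) (trans (tri₋-suc n) (sym (tri₊≡tri₋+n n))) ⟩
  tri₊ n ℕ.+ suc n               ∎
  where open ≡-Reasoning

weightᵃ weightᵇ : ℕ → ℕ → ℕ
weightᵃ i j = tri₋ (i ℕ.+ j) ℕ.+ tri₊ i
weightᵇ i j = tri₊ (i ℕ.+ j) ℕ.+ tri₊ i

weightᵃ-sucⱼ : ∀ i j → weightᵃ i (suc j) ≡ 0 ℕ.+ i ℕ.+ j ℕ.+ weightᵃ i j
weightᵃ-sucⱼ i j rewrite ℕₚ.+-suc i j | tri₋-suc (i ℕ.+ j) = arith i j (tri₋ (i ℕ.+ j)) (tri₊ i)
  where
  arith : ∀ i j t u → t ℕ.+ (i ℕ.+ j) ℕ.+ u ≡ i ℕ.+ j ℕ.+ (t ℕ.+ u)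
  arith = solve-∀

weightᵃ-sucᵢ : ∀ i j → weightᵃ (suc i) j ≡ 0 ℕ.+ 2 ℕ.* i ℕ.+ j ℕ.+ 1 ℕ.+ weightᵃ i j
weightᵃ-sucᵢ i j rewrite tri₋-suc (i ℕ.+ j) | tri₊-suc i = arith i j (tri₋ (i ℕ.+ j)) (tri₊ i)
  where
  arith : ∀ i j t u → t ℕ.+ (i ℕ.+ j) ℕ.+ (u ℕ.+ suc i) ≡ 2 ℕ.* i ℕ.+ j ℕ.+ 1 ℕ.+ (t ℕ.+ u)
  arith = solve-∀

weightᵇ-sucⱼ : ∀ i j → weightᵇ i (suc j) ≡ 1 ℕ.+ i ℕ.+ j ℕ.+ weightᵇ i j
weightᵇ-sucⱼ i j rewrite ℕₚ.+-suc i j | tri₊-suc (i ℕ.+ j) = arith i j (tri₊ (i ℕ.+ j)) (tri₊ i)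
  where
  arith : ∀ i j t u → t ℕ.+ suc (i ℕ.+ j) ℕ.+ u ≡ 1 ℕ.+ i ℕ.+ j ℕ.+ (t ℕ.+ u)
  arith = solve-∀

weightᵇ-sucᵢ : ∀ i j → weightᵇ (suc i) j ≡ 1 ℕ.+ 2 ℕ.* i ℕ.+ j ℕ.+ 1 ℕ.+ weightᵇ i j
weightᵇ-sucᵢ i j rewrite tri₊-suc (i ℕ.+ j) | tri₊-suc i = arith i j (tri₊ (i ℕ.+ j)) (tri₊ i)
  where
  arith : ∀ i j t u → t ℕ.+ suc (i ℕ.+ j) ℕ.+ (u ℕ.+ suc i) ≡ 1 ℕ.+ 2 ℕ.* i ℕ.+ j ℕ.+ 1 ℕ.+ (t ℕ.+ u)
  arith = solve-∀

module Aₘ = TrinomialSum weightᵃ 0 weightᵃ-sucⱼ weightᵃ-sucᵢ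
module Bₘ = TrinomialSum weightᵇ 1 weightᵇ-sucⱼ weightᵇ-sucᵢ

aₘ≈trinomialSum : ∀ M → aₘ (suc M) ≈ₚ Aₘ.trinomialSum 0 M
aₘ≈trinomialSum M = GaussDoubleSum.gaussDoubleSum≈simplexSum (λ n l → tri₋ n ℕ.+ tri₊ l) M (suc M) (ℕₚ.n≤1+n M)

bₘ≈trinomialSum : ∀ M → bₘ (suc (suc M)) ≈ₚ Bₘ.trinomialSum 0 M
bₘ≈trinomialSum M = GaussDoubleSum.gaussDoubleSum≈simplexSum (λ n l → tri₊ n ℕ.+ tri₊ l) M (suc (suc M))
                                                             (ℕₚ.≤-trans (ℕₚ.n≤1+n M) (ℕₚ.n≤1+n (suc M)))

aₘ≈trinomialSum₁ : ∀ M → Aₘ.trinomialSum 1 M ≈ₚ aₘ M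
aₘ≈trinomialSum₁ zero    = ≈ₚ-refl
aₘ≈trinomialSum₁ (suc M) = ≈ₚ-trans (simplexSum-pred 0 M Aₘ.term) (≈ₚ-sym (aₘ≈trinomialSum M))

bₘ-one : bₘ 1 ≈ₚ zeroPS
bₘ-one = ΣP-zero 1 _ (λ n _ → ΣP-zero 1 _ (λ l _ →
  ⊛-absorbˡ (gauss (ℤ.+ n) l) (⊛-absorbʳ (X^ (tri₊ n ℕ.+ tri₊ l)) (negative n l))))
  where
  negative : ∀ n l → gauss (ℤ.+ 1 ℤ.- ℤ.+ 2 ℤ.- ℤ.+ l) n ≈ₚ zeroPS
  negative n zero    = ≈ₚ-refl
  negative n (suc l) = ≈ₚ-refl

aₘ-one : aₘ 1 ≈ₚ onePS
aₘ-one = ≈ₚ-trans (aₘ≈trinomialSum 0) (≈ₚ-trans (⊛-cong X^-zero trinomial-zero) (⊛-identityˡ onePS))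

bₘ≈trinomialSum₁ : ∀ M → Bₘ.trinomialSum 1 M ≈ₚ bₘ (suc M)
bₘ≈trinomialSum₁ zero    = ≈ₚ-sym bₘ-one
bₘ≈trinomialSum₁ (suc M) = ≈ₚ-trans (simplexSum-pred 0 M Bₘ.term) (≈ₚ-sym (bₘ≈trinomialSum M))

aₘ-rec : LinearRecurrence X^ (λ m → onePS ⊕ X^ m) aₘ
aₘ-rec .step M = begin
  aₘ (suc (suc M))
    ≈⟨ aₘ≈trinomialSum (suc M) ⟩
  Aₘ.trinomialSum 0 (suc M)
    ≈⟨ Aₘ.trinomialSum-rec M ⟩
  F ⊕ X^ (M ℕ.+ 0) ⊛ F ⊕ X^ (M ℕ.+ 0) ⊛ G
    ≈⟨ ⊕-cong (⊕-cong (≈ₚ-sym (aₘ≈trinomialSum M)) (⊛-cong x≈ (≈ₚ-sym (aₘ≈trinomialSum M)))) (⊛-cong x≈ (aₘ≈trinomialSum₁ M)) ⟩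
  aₘ (suc M) ⊕ X^ M ⊛ aₘ (suc M) ⊕ X^ M ⊛ aₘ M
    ≈⟨ solve 3 (λ a₁ a₀ x → a₁ :+ x :* a₁ :+ x :* a₀ := x :* a₀ :+ (con 1ℚ :+ x) :* a₁)
           ≈ₚ-refl (aₘ (suc M)) (aₘ M) (X^ M) ⟩
  X^ M ⊛ aₘ M ⊕ (onePS ⊕ X^ M) ⊛ aₘ (suc M) ∎
  where
  open ≈ₚ-Reasoning
  open PS-Solver using (solve; _:=_; _:+_; _:*_; con)
  F = Aₘ.trinomialSum 0 M
  G = Aₘ.trinomialSum 1 M
  x≈ : X^ (M ℕ.+ 0) ≈ₚ X^ M
  x≈ = X^-cong (ℕₚ.+-identityʳ M)

bₘ-rec : LinearRecurrence X^ (λ m → onePS ⊕ X^ m) bₘ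
bₘ-rec .step zero = begin
  bₘ 2
    ≈⟨ bₘ≈trinomialSum 0 ⟩
  X^ 0 ⊛ trinomial 0 0 0
    ≈⟨ ⊛-congˡ (X^ 0) trinomial-zero ⟩
  X^ 0 ⊛ onePS
    ≈⟨ (λ N → +-identityʳ _) ⟨
  X^ 0 ⊛ onePS ⊕ zeroPS
    ≈⟨ ⊕-cong (≈ₚ-refl {X^ 0 ⊛ onePS}) (⊛-zeroʳ (onePS ⊕ X^ 0)) ⟨
  X^ 0 ⊛ onePS ⊕ (onePS ⊕ X^ 0) ⊛ zeroPS
    ≈⟨ ⊕-cong (≈ₚ-refl {X^ 0 ⊛ onePS}) (⊛-congˡ (onePS ⊕ X^ 0) (≈ₚ-sym bₘ-one)) ⟩
  X^ 0 ⊛ bₘ 0 ⊕ (onePS ⊕ X^ 0) ⊛ bₘ 1 ∎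
  where open ≈ₚ-Reasoning
bₘ-rec .step (suc M) = begin
  bₘ (suc (suc (suc M)))
    ≈⟨ bₘ≈trinomialSum (suc M) ⟩
  Bₘ.trinomialSum 0 (suc M)
    ≈⟨ Bₘ.trinomialSum-rec M ⟩
  F ⊕ X^ (M ℕ.+ 1) ⊛ F ⊕ X^ (M ℕ.+ 1) ⊛ G
    ≈⟨ ⊕-cong (⊕-cong (≈ₚ-sym (bₘ≈trinomialSum M)) (⊛-cong x≈ (≈ₚ-sym (bₘ≈trinomialSum M))))
              (⊛-cong x≈ (bₘ≈trinomialSum₁ M)) ⟩
  b₂ ⊕ X^ (suc M) ⊛ b₂ ⊕ X^ (suc M) ⊛ b₁
    ≈⟨ solve 3 (λ b₂ b₁ x → b₂ :+ x :* b₂ :+ x :* b₁ := x :* b₁ :+ (con 1ℚ :+ x) :* b₂)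
           ≈ₚ-refl b₂ b₁ (X^ (suc M)) ⟩
  X^ (suc M) ⊛ b₁ ⊕ (onePS ⊕ X^ (suc M)) ⊛ b₂ ∎
  where
  open ≈ₚ-Reasoning
  open PS-Solver using (solve; _:=_; _:+_; _:*_; con)
  F  = Bₘ.trinomialSum 0 M
  G  = Bₘ.trinomialSum 1 M
  b₁ = bₘ (suc M)
  b₂ = bₘ (suc (suc M))
  x≈ : X^ (M ℕ.+ 1) ≈ₚ X^ (suc M)
  x≈ = X^-cong (ℕₚ.+-comm M 1)

bracket≈ : ∀ m → aₘ m ⊛ A∞ ⊕ bₘ m ⊛ (⊝ A∞ ⊖ B∞) ≈ₚ bracket m
bracket≈ m = solve 4 (λ a b x y → a :* x :+ b :* ((:- x) :- y) := (a :- b) :* x :- b :* y) ≈ₚ-refl (aₘ m) (bₘ m) A∞ B∞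
  where open PS-Solver using (solve; _:=_; _:+_; _:-_; _:*_; :-_)

rhs-rec : LinearRecurrence X^ (λ m → ⊝ (onePS ⊕ X^ m)) (λ m → (- sgn m) · bracket m)
rhs-rec = LinearRecurrence-alternate
            (LinearRecurrence-cong bracket≈ (LinearRecurrence-combine aₘ-rec bₘ-rec A∞ (⊝ A∞ ⊖ B∞)))

lhs-rec : LinearRecurrence X^ (λ m → ⊝ (onePS ⊕ X^ m)) (λ m → X^ (tri₋ m) ⊛ lhs m)
lhs-rec .step m = begin
  X^ (tri₋ (suc (suc m))) ⊛ lhs (suc (suc m))
    ≈⟨ ⊛-cong (≈ₚ-trans (X^-cong exponent₂) (≈ₚ-trans (≈ₚ-sym (X^-⊛-X^ (t ℕ.+ m) (m ℕ.+ 1)))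
                                                     (⊛-cong (≈ₚ-sym (X^-⊛-X^ t m)) (≈ₚ-sym (X^-⊛-X^ m 1)))))
              (lhs≈lhsSum (suc (suc m))) ⟩
  ((x ⊛ y) ⊛ (y ⊛ X^ 1)) ⊛ S₂
    ≈⟨ solve 5 (λ x y z s₁ s₂ → (x :* y) :* (y :* z) :* s₂
                                := y :* (x :* (s₁ :+ y :* s₁ :+ y :* (z :* s₂))) :+ (:- (con 1ℚ :+ y)) :* ((x :* y) :* s₁))
               ≈ₚ-refl x y (X^ 1) S₁ S₂ ⟩
  y ⊛ (x ⊛ (S₁ ⊕ y ⊛ S₁ ⊕ y ⊛ (X^ 1 ⊛ S₂))) ⊕ (⊝ (onePS ⊕ y)) ⊛ ((x ⊛ y) ⊛ S₁)
    ≈⟨ ⊕-cong (⊛-congˡ y (⊛-congˡ x (≈ₚ-trans (≈ₚ-sym (lhsSum-rec m)) (≈ₚ-sym (lhs≈lhsSum m)))))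
              (⊛-congˡ (⊝ (onePS ⊕ y)) (⊛-cong (≈ₚ-trans (X^-⊛-X^ t m) (X^-cong (sym (tri₋-suc m)))) (≈ₚ-sym (lhs≈lhsSum (suc m))))) ⟩
  y ⊛ (x ⊛ lhs m) ⊕ (⊝ (onePS ⊕ y)) ⊛ (X^ (tri₋ (suc m)) ⊛ lhs (suc m)) ∎
  where
  open ≈ₚ-Reasoning
  open PS-Solver using (solve; _:=_; _:+_; _:*_; :-_; con)
  t  = tri₋ m
  x  = X^ t
  y  = X^ m
  S₁ = lhsSum (suc m)
  S₂ = lhsSum (suc (suc m))
  exponent₂ : tri₋ (suc (suc m)) ≡ t ℕ.+ m ℕ.+ (m ℕ.+ 1)
  exponent₂ = trans (tri₋-suc (suc m)) (cong₂ ℕ._+_ (tri₋-suc m) (ℕₚ.+-comm 1 m))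

initial₀ : X^ (tri₋ 0) ⊛ lhs 0 ≈ₚ (- sgn 0) · bracket 0
initial₀ = begin
  X^ 0 ⊛ lhs 0
    ≈⟨ ⊛-congʳ (lhs 0) X^-zero ⟩
  onePS ⊛ lhs 0
    ≈⟨ ⊛-identityˡ (lhs 0) ⟩
  lhs 0
    ≈⟨ ≈ₚ-trans (lhs≈lhsSum 0) lhsSum-zero ⟩
  A∞ ⊕ B∞
    ≈⟨ solve 2 (λ a b → a :+ b := con (- 1ℚ) :* ((con 0ℚ :- con 1ℚ) :* a :- con 1ℚ :* b))
           ≈ₚ-refl A∞ B∞ ⟩
  cst (- 1ℚ) ⊛ ((cst 0ℚ ⊖ onePS) ⊛ A∞ ⊖ onePS ⊛ B∞)
    ≈⟨ ⊛-congˡ (cst (- 1ℚ)) (⊖-cong (⊛-congʳ A∞ (⊖-cong (≈ₚ-sym cst-zero) (≈ₚ-refl {onePS}))) (≈ₚ-refl {onePS ⊛ B∞})) ⟨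
  cst (- 1ℚ) ⊛ bracket 0
    ≈⟨ cst-⊛ (- 1ℚ) (bracket 0) ⟩
  (- 1ℚ) · bracket 0 ∎
  where
  open ≈ₚ-Reasoning
  open PS-Solver using (solve; _:=_; _:+_; _:-_; _:*_; con)

initial₁ : X^ (tri₋ 1) ⊛ lhs 1 ≈ₚ (- sgn 1) · bracket 1
initial₁ = begin
  X^ 0 ⊛ lhs 1                                          ≈⟨ ⊛-congʳ (lhs 1) X^-zero ⟩
  onePS ⊛ lhs 1                                         ≈⟨ ⊛-identityˡ (lhs 1) ⟩
  lhs 1                                                 ≈⟨ ≈ₚ-trans (lhs≈lhsSum 1) lhsSum-one ⟩
  A∞
    ≈⟨ solve 2 (λ a b → a := con 1ℚ :* ((con 1ℚ :- con 0ℚ) :* a :- con 0ℚ :* b))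
           ≈ₚ-refl A∞ B∞ ⟩
  cst 1ℚ ⊛ ((onePS ⊖ cst 0ℚ) ⊛ A∞ ⊖ cst 0ℚ ⊛ B∞)
    ≈⟨ ⊛-congˡ (cst 1ℚ) (⊖-cong (⊛-congʳ A∞ (⊖-cong aₘ-one b₁≈0)) (⊛-congʳ B∞ b₁≈0)) ⟨
  cst 1ℚ ⊛ bracket 1                                    ≈⟨ cst-⊛ 1ℚ (bracket 1) ⟩
  (- sgn 1) · bracket 1                                 ∎
  where
  open ≈ₚ-Reasoning
  open PS-Solver using (solve; _:=_; _:+_; _:-_; _:*_; con)
  b₁≈0 : bₘ 1 ≈ₚ cst 0ℚ
  b₁≈0 = ≈ₚ-trans bₘ-one (≈ₚ-sym cst-zero)

corollary2p12 : (m : ℕ) → X^ (tri₋ m) ⊛ lhs m ≈ₚ (- sgn m) · bracket m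
corollary2p12 = LinearRecurrence-unique lhs-rec rhs-rec initial₀ initial₁
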